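{- Let $\mathcal{C}$ be a hypergraph and $F$ an edge of $\mathcal{C}$. Then there is a long exact sequence of reduced homology groups (integer coefficients) $$\cdots\to \tilde H_{i-|F|+1}(\operatorname{Ind}(\mathcal{C}:F))\to \tilde H_i(\operatorname{Ind}(\mathcal{C}))\to \tilde H_i(\operatorname{Ind}(\mathcal{C}-F))\to \tilde H_{i-|F|}(\operatorname{Ind}(\mathcal{C}:F))\to\cdots$$
   Context: A hypergraph $\mathcal{C}$ on a finite vertex set $V$ is a family of pairwise incomparable subsets of $V$ (edges), each of cardinality at least $2$. $\operatorname{Ind}(\mathcal{C})$ is the simplicial complex on $V$ of subsets containing no edge. For an edge $F$: $\mathcal{C}-F$ is the hypergraph on $V$ with edge set $\mathcal{C}\setminus\{F\}$; $N_{\mathcal{C}}(F)=\bigcup\{E\setminus F: E\in\mathcal{C}, |E\setminus F|=1\}$; $\mathcal{C}:F$ is the hypergraph on $V\setminus(F\cup N_{\mathcal{C}}(F))$ whose edges are the inclusion-minimal sets among $\{E\setminus F: E\in\mathcal{C}-F\}$ of size at least $2$ (those meeting $N_{\mathcal{C}}(F)$ discarded), so that $\operatorname{Ind}(\mathcal{C}:F)$ is the link of $F$ in $\operatorname{Ind}(\mathcal{C}-F)$. -}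

module Defs where

open import Data.Bool using (Bool; true; false; not; _∧_; _∨_; if_then_else_)
open import Data.Nat using (ℕ; zero; suc; _≤_; _≡ᵇ_)
open import Data.Integer using (ℤ; +_; _+_; _-_; _*_; -_; 0ℤ; 1ℤ)
open import Data.Fin using (Fin; zero; suc)
open import Data.Fin.Subset using (Subset; ∣_∣; _∪_; _─_; ⁅_⁆; ∁; _∩_; ⊥; _⊆_)
open import Data.Vec using (Vec; []; _∷_; lookup)
open import Data.List using (List; []; _∷_)
open import Data.List.Membership.Propositional using (_∈_)
open import Data.Product using (Σ; _×_)
open import Relation.Binary.PropositionalEquality using (_≡_)

_⊆ᵇ_ : ∀ {n} → Subset n → Subset n → Bool
[] ⊆ᵇ [] = true
(x ∷ xs) ⊆ᵇ (y ∷ ys) = (not x ∨ y) ∧ (xs ⊆ᵇ ys)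

_⊂ᵇ_ : ∀ {n} → Subset n → Subset n → Bool
A ⊂ᵇ B = (A ⊆ᵇ B) ∧ not (B ⊆ᵇ A)

_=ᵇ_ : ∀ {n} → Subset n → Subset n → Bool
A =ᵇ B = (A ⊆ᵇ B) ∧ (B ⊆ᵇ A)

isEmptyᵇ : ∀ {n} → Subset n → Bool
isEmptyᵇ A = ∣ A ∣ ≡ᵇ 0

allᵇ : {A : Set} → (A → Bool) → List A → Bool
allᵇ p [] = true
allᵇ p (x ∷ xs) = p x ∧ allᵇ p xs

filterᵇ : {A : Set} → (A → Bool) → List A → List A
filterᵇ p [] = []
filterᵇ p (x ∷ xs) = if p x then x ∷ filterᵇ p xs else filterᵇ p xs

mapL : {A B : Set} → (A → B) → List A → List B
mapL f [] = []
mapL f (x ∷ xs) = f x ∷ mapL f xs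

-- Hypergraphs on the vertex set V = Fin n, given by the (finite) list
-- of their edges (repetitions in the list are immaterial).

Hypergraph : ℕ → Set
Hypergraph n = List (Subset n)

IsHypergraph : ∀ {n} → Hypergraph n → Set
IsHypergraph C =
  (∀ {E} → E ∈ C → 2 ≤ ∣ E ∣) ×
  (∀ {E E'} → E ∈ C → E' ∈ C → E ⊆ E' → E ≡ E')

Complex : ℕ → Set
Complex n = Subset n → Bool

IndOn : ∀ {n} → Subset n → Hypergraph n → Complex n
IndOn W C σ = (σ ⊆ᵇ W) ∧ allᵇ (λ E → not (E ⊆ᵇ σ)) C

Ind : ∀ {n} → Hypergraph n → Complex n
Ind {n} C = IndOn (∁ ⊥) C

_−ₑ_ : ∀ {n} → Hypergraph n → Subset n → Hypergraph n
C −ₑ F = filterᵇ (λ E → not (E =ᵇ F)) C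

Nbhd : ∀ {n} → Hypergraph n → Subset n → Subset n
Nbhd [] F = ⊥
Nbhd (E ∷ C) F = if ∣ E ─ F ∣ ≡ᵇ 1 then (E ─ F) ∪ Nbhd C F else Nbhd C F

colonVertices : ∀ {n} → Hypergraph n → Subset n → Subset n
colonVertices C F = ∁ (F ∪ Nbhd C F)

colonCandidates : ∀ {n} → Hypergraph n → Subset n → List (Subset n)
colonCandidates C F =
  filterᵇ (λ D → not (∣ D ∣ ≡ᵇ 0) ∧ not (∣ D ∣ ≡ᵇ 1) ∧ isEmptyᵇ (D ∩ Nbhd C F))
          (mapL (λ E → E ─ F) (C −ₑ F))

colonEdges : ∀ {n} → Hypergraph n → Subset n → Hypergraph n
colonEdges C F =
  filterᵇ (λ D → allᵇ (λ D' → not (D' ⊂ᵇ D)) (colonCandidates C F))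
          (colonCandidates C F)

IndColon : ∀ {n} → Hypergraph n → Subset n → Complex n
IndColon C F = IndOn (colonVertices C F) (colonEdges C F)

-- Degree i ∈ ℤ; the i-faces are faces with i+1 vertices (the empty face
-- has dimension -1, which gives the augmentation / reduced homology).
-- Simplices are oriented by the order of Fin n.

sumFin : ∀ {n} → (Fin n → ℤ) → ℤ
sumFin {zero} f = 0ℤ
sumFin {suc n} f = f zero + sumFin (λ v → f (suc v))

countBelow : ∀ {n} → Subset n → Fin n → ℕ
countBelow (b ∷ σ) zero = 0
countBelow (b ∷ σ) (suc v) = (if b then 1 else 0) Data.Nat.+ countBelow σ v

sgn : ℕ → ℤ
sgn zero = 1ℤ
sgn (suc k) = - sgn k

-- integer chains (only values on faces of the relevant dimension matter)
Chain : ℕ → Set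
Chain n = Subset n → ℤ

IsDimFace : ∀ {n} → Complex n → ℤ → Subset n → Set
IsDimFace Δ i σ = (Δ σ ≡ true) × (+ ∣ σ ∣ ≡ i + 1ℤ)

∂ : ∀ {n} → Complex n → Chain n → Chain n
∂ Δ f σ = sumFin (λ v →
  if not (lookup σ v) ∧ Δ (σ ∪ ⁅ v ⁆)
  then sgn (countBelow σ v) * f (σ ∪ ⁅ v ⁆)
  else 0ℤ)

record Cycle {n} (Δ : Complex n) (i : ℤ) : Set where
  field
    chain : Chain n
    isCycle : ∀ σ → IsDimFace Δ (i - 1ℤ) σ → ∂ Δ chain σ ≡ 0ℤ
open Cycle public

IsBoundary : ∀ {n} → Complex n → ℤ → Chain n → Set
IsBoundary {n} Δ i f =
  Σ (Chain n) λ h → ∀ σ → IsDimFace Δ i σ → ∂ Δ h σ ≡ f σ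

Homologous : ∀ {n} (Δ : Complex n) (i : ℤ) → Cycle Δ i → Cycle Δ i → Set
Homologous Δ i z w = IsBoundary Δ i (λ σ → chain z σ - chain w σ)

-- a group homomorphism H_i(Δ) → H_j(Δ'), presented on cycle representatives
record Hom {n} (Δ : Complex n) (i : ℤ) (Δ' : Complex n) (j : ℤ) : Set where
  field
    fun : Cycle Δ i → Cycle Δ' j
    resp : ∀ z w → Homologous Δ i z w → Homologous Δ' j (fun z) (fun w)
    additive : ∀ z w s →
      (∀ σ → IsDimFace Δ i σ → chain s σ ≡ chain z σ + chain w σ) →
      IsBoundary Δ' j (λ σ → chain (fun s) σ - (chain (fun z) σ + chain (fun w) σ))
open Hom public

Exact : ∀ {n} {Δ₁ Δ₂ Δ₃ : Complex n} {i j k : ℤ} →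
        Hom Δ₁ i Δ₂ j → Hom Δ₂ j Δ₃ k → Set
Exact {Δ₁ = Δ₁} {Δ₂} {Δ₃} {i} {j} {k} f g =
  (∀ a → IsBoundary Δ₃ k (chain (fun g (fun f a)))) ×
  (∀ b → IsBoundary Δ₃ k (chain (fun g b)) →
         Σ (Cycle Δ₁ i) λ a → Homologous Δ₂ j (fun f a) b)

LongExact : ∀ {n} → Complex n → Complex n → Complex n → ℕ → Set
LongExact K K' L d =
  Σ (∀ i → Hom K i K' i) λ b →
  Σ (∀ i → Hom K' i L (i - + d)) λ c →
  Σ (∀ i → Hom L (i - + d) K (i - 1ℤ)) λ a →
  ∀ i → Exact (b i) (c i) × Exact (c i) (a i) × Exact (a i) (b (i - 1ℤ))

-- Write K = Ind(C), K′ = Ind(C − F) and L = Ind(C : F). A face of K′ lies in K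
-- exactly when it does not contain F, and the faces of K′ containing F are the sets
-- τ ∪ F with τ a face of the link of F in K′, which is L (here one uses that C is an
-- antichain, so E ∖ F ≠ ∅ for the other edges E). Hence τ ↦ τ ∪ F, twisted by the
-- sign of the shuffle of τ and F, identifies C(K′)/C(K) with C(L) shifted by |F|, and
-- the theorem is the long exact sequence of 0 → C(K) → C(K′) → C(L)[|F|] → 0, whose
-- connecting map sends a cycle w of L to ∂ of its lift to K′.

module Submission where

open import Defs
open import Data.Bool using (Bool; true; false; not; _∧_; _∨_; if_then_else_)
open import Data.Bool.Properties
  using (∧-conicalˡ; ∧-conicalʳ; ∧-zeroʳ; ∧-identityʳ; ∨-conicalˡ; ∨-conicalʳ; ∨-zeroʳ; ∨-identityʳ; not-injective; T-≡)
open import Data.Empty using (⊥-elim)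
open import Data.Fin using (Fin; zero; suc; _≟_)
open import Data.Fin.Subset using (Subset; ∣_∣; _∪_; _─_; ⁅_⁆; ∁; _∩_; ⊥; _⊆_)
open import Data.Fin.Subset.Properties using (∪-assoc; ∪-comm; ∪-identityʳ; ∣⁅x⁆∣≡1; p⊂q⇒∣p∣<∣q∣)
open import Data.Integer using (ℤ; +_; _+_; _-_; _*_; -_; 0ℤ; 1ℤ)
import Data.Integer.Properties as ℤ
open import Data.Integer.Tactic.RingSolver using (solve-∀)
open import Data.Nat as ℕ using (ℕ; zero; suc)
import Data.Nat.Properties as ℕ
open import Data.List using (List; []; _∷_)
open import Data.List.Membership.Propositional using (_∈_)
open import Data.List.Relation.Unary.Any using (here; there)
open import Data.Product using (Σ; ∃; _×_; _,_; proj₁; proj₂; map₁)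
open import Data.Vec using ([]; _∷_; lookup)
open import Data.Vec.Properties using (lookup-zipWith; lookup-map; lookup-replicate; lookup⇒[]=; []=⇒lookup)
open import Relation.Binary.PropositionalEquality
open import Function.Bundles using (Equivalence)
open import Relation.Nullary using (Dec; yes; no)

true≢false : ∀ {b} → b ≡ true → b ≡ false → ∀ {A : Set} → A
true≢false refl ()

if-true : ∀ {A : Set} {b} {x y : A} → b ≡ true → (if b then x else y) ≡ x
if-true refl = refl

if-false : ∀ {A : Set} {b} {x y : A} → b ≡ false → (if b then x else y) ≡ y
if-false refl = refl

not-true : ∀ {b} → not b ≡ true → b ≡ false
not-true {false} _ = refl

not-false : ∀ {b} → b ≡ false → not b ≡ true
not-false refl = refl

∧-intro : ∀ {a b} → a ≡ true → b ≡ true → a ∧ b ≡ true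
∧-intro refl refl = refl

bool-ext : ∀ {a b} → (a ≡ true → b ≡ true) → (b ≡ true → a ≡ true) → a ≡ b
bool-ext {true}  {true}  to from = refl
bool-ext {true}  {false} to from = sym (to refl)
bool-ext {false} {true}  to from = from refl
bool-ext {false} {false} to from = refl

case-bool : ∀ {P : Set} b → (b ≡ true → P) → (b ≡ false → P) → P
case-bool true  t f = t refl
case-bool false t f = f refl

infix 4.5 _∈ᵇ_

_∈ᵇ_ : ∀ {n} → Fin n → Subset n → Bool
v ∈ᵇ σ = lookup σ v

Disjoint : ∀ {n} → Subset n → Subset n → Set
Disjoint p q = ∀ v → v ∈ᵇ p ≡ true → v ∈ᵇ q ≡ false

subset-ext : ∀ {n} (p q : Subset n) → (∀ v → v ∈ᵇ p ≡ v ∈ᵇ q) → p ≡ q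
subset-ext []      []      h = refl
subset-ext (x ∷ p) (y ∷ q) h = cong₂ _∷_ (h zero) (subset-ext p q (λ v → h (suc v)))

∈ᵇ-∪ : ∀ {n} (p q : Subset n) v → (v ∈ᵇ p ∪ q) ≡ ((v ∈ᵇ p) ∨ (v ∈ᵇ q))
∈ᵇ-∪ p q v = lookup-zipWith _∨_ v p q

∈ᵇ-∩ : ∀ {n} (p q : Subset n) v → (v ∈ᵇ p ∩ q) ≡ ((v ∈ᵇ p) ∧ (v ∈ᵇ q))
∈ᵇ-∩ p q v = lookup-zipWith _∧_ v p q

∈ᵇ-∁ : ∀ {n} (p : Subset n) v → (v ∈ᵇ ∁ p) ≡ not (v ∈ᵇ p)
∈ᵇ-∁ p v = lookup-map v not p

∈ᵇ-⊥ : ∀ {n} (v : Fin n) → v ∈ᵇ ⊥ ≡ false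
∈ᵇ-⊥ v = lookup-replicate v false

∈ᵇ-─ : ∀ {n} (p q : Subset n) v → (v ∈ᵇ p ─ q) ≡ ((v ∈ᵇ p) ∧ not (v ∈ᵇ q))
∈ᵇ-─ (x     ∷ p) (true  ∷ q) zero    = sym (∧-zeroʳ x)
∈ᵇ-─ (false ∷ p) (false ∷ q) zero    = refl
∈ᵇ-─ (true  ∷ p) (false ∷ q) zero    = refl
∈ᵇ-─ (x     ∷ p) (y     ∷ q) (suc v) = ∈ᵇ-─ p q v

∈ᵇ-⁅⁆ : ∀ {n} (v : Fin n) → v ∈ᵇ ⁅ v ⁆ ≡ true
∈ᵇ-⁅⁆ zero    = refl
∈ᵇ-⁅⁆ (suc v) = ∈ᵇ-⁅⁆ v

∈ᵇ-⁅⁆-≢ : ∀ {n} {v w : Fin n} → v ≢ w → w ∈ᵇ ⁅ v ⁆ ≡ false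
∈ᵇ-⁅⁆-≢ {v = zero}  {zero}  v≢w = ⊥-elim (v≢w refl)
∈ᵇ-⁅⁆-≢ {v = zero}  {suc w} v≢w = ∈ᵇ-⊥ w
∈ᵇ-⁅⁆-≢ {v = suc v} {zero}  v≢w = refl
∈ᵇ-⁅⁆-≢ {v = suc v} {suc w} v≢w = ∈ᵇ-⁅⁆-≢ (λ v≡w → v≢w (cong suc v≡w))

∈ᵇ-⁅⁆⇒≡ : ∀ {n} {v w : Fin n} → w ∈ᵇ ⁅ v ⁆ ≡ true → v ≡ w
∈ᵇ-⁅⁆⇒≡ {v = v} {w} w∈v with v ≟ w
... | yes v≡w = v≡w
... | no  v≢w = true≢false w∈v (∈ᵇ-⁅⁆-≢ v≢w)

⊆ᵇ⇒ : ∀ {n} (A B : Subset n) → A ⊆ᵇ B ≡ true → ∀ v → v ∈ᵇ A ≡ true → v ∈ᵇ B ≡ true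
⊆ᵇ⇒ (true ∷ A) (true ∷ B) A⊆B zero    _   = refl
⊆ᵇ⇒ (x    ∷ A) (y    ∷ B) A⊆B (suc v) v∈A = ⊆ᵇ⇒ A B (∧-conicalʳ (not x ∨ y) _ A⊆B) v v∈A

⊆ᵇ⁺ : ∀ {n} (A B : Subset n) → (∀ v → v ∈ᵇ A ≡ true → v ∈ᵇ B ≡ true) → A ⊆ᵇ B ≡ true
⊆ᵇ⁺ []          []          h = refl
⊆ᵇ⁺ (false ∷ A) (false ∷ B) h = ⊆ᵇ⁺ A B (λ v → h (suc v))
⊆ᵇ⁺ (false ∷ A) (true  ∷ B) h = ⊆ᵇ⁺ A B (λ v → h (suc v))
⊆ᵇ⁺ (true  ∷ A) (true  ∷ B) h = ⊆ᵇ⁺ A B (λ v → h (suc v))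
⊆ᵇ⁺ (true  ∷ A) (false ∷ B) h with () ← h zero refl

⊆ᵇ-witness : ∀ {n} {A B : Subset n} → A ⊆ᵇ B ≡ false →
  ∃ λ v → (v ∈ᵇ A ≡ true) × (v ∈ᵇ B ≡ false)
⊆ᵇ-witness {A = []}        {[]}        ()
⊆ᵇ-witness {A = true  ∷ A} {false ∷ B} _ = zero , refl , refl
⊆ᵇ-witness {A = true  ∷ A} {true  ∷ B} e with v , p , q ← ⊆ᵇ-witness {A = A} {B} e = suc v , p , q
⊆ᵇ-witness {A = false ∷ A} {y     ∷ B} e with v , p , q ← ⊆ᵇ-witness {A = A} {B} e = suc v , p , q

∪⁅⁆-new : ∀ {n} (σ : Subset n) v → v ∈ᵇ σ ∪ ⁅ v ⁆ ≡ true
∪⁅⁆-new σ v = trans (∈ᵇ-∪ σ ⁅ v ⁆ v) (trans (cong ((v ∈ᵇ σ) ∨_) (∈ᵇ-⁅⁆ v)) (∨-zeroʳ _))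

∪-keepˡ : ∀ {n} (σ τ : Subset n) {w} → w ∈ᵇ σ ≡ true → w ∈ᵇ σ ∪ τ ≡ true
∪-keepˡ σ τ {w} w∈σ = trans (∈ᵇ-∪ σ τ w) (cong (_∨ (w ∈ᵇ τ)) w∈σ)

∪-keepʳ : ∀ {n} (σ τ : Subset n) {w} → w ∈ᵇ τ ≡ true → w ∈ᵇ σ ∪ τ ≡ true
∪-keepʳ σ τ {w} w∈τ = trans (∈ᵇ-∪ σ τ w) (trans (cong ((w ∈ᵇ σ) ∨_) w∈τ) (∨-zeroʳ _))

∪-avoid : ∀ {n} (σ τ : Subset n) {w} → w ∈ᵇ σ ≡ false → w ∈ᵇ τ ≡ false → w ∈ᵇ σ ∪ τ ≡ false
∪-avoid σ τ {w} w∉σ w∉τ = trans (∈ᵇ-∪ σ τ w) (cong₂ _∨_ w∉σ w∉τ)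

∪-swap : ∀ {n} (a b c : Subset n) → (a ∪ b) ∪ c ≡ (a ∪ c) ∪ b
∪-swap a b c = begin
  (a ∪ b) ∪ c  ≡⟨ ∪-assoc a b c ⟩
  a ∪ (b ∪ c)  ≡⟨ cong (a ∪_) (∪-comm b c) ⟩
  a ∪ (c ∪ b)  ≡⟨ ∪-assoc a c b ⟨
  (a ∪ c) ∪ b  ∎
  where open ≡-Reasoning

disjoint-⁅⁆ : ∀ {n} (σ : Subset n) {v} → v ∈ᵇ σ ≡ false → Disjoint σ ⁅ v ⁆
disjoint-⁅⁆ σ {v} v∉σ w w∈σ with v ≟ w
... | yes refl = true≢false w∈σ v∉σ
... | no  v≢w  = ∈ᵇ-⁅⁆-≢ v≢w

∣∪∣-disjoint : ∀ {n} (p q : Subset n) → Disjoint p q → ∣ p ∪ q ∣ ≡ ∣ p ∣ ℕ.+ ∣ q ∣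
∣∪∣-disjoint []          []          _ = refl
∣∪∣-disjoint (true  ∷ p) (true  ∷ q) d with () ← d zero refl
∣∪∣-disjoint (true  ∷ p) (false ∷ q) d = cong suc (∣∪∣-disjoint p q (λ v → d (suc v)))
∣∪∣-disjoint (false ∷ p) (true  ∷ q) d =
  trans (cong suc (∣∪∣-disjoint p q (λ v → d (suc v)))) (sym (ℕ.+-suc ∣ p ∣ ∣ q ∣))
∣∪∣-disjoint (false ∷ p) (false ∷ q) d = ∣∪∣-disjoint p q (λ v → d (suc v))

∣∪⁅⁆∣ : ∀ {n} (σ : Subset n) {v} → v ∈ᵇ σ ≡ false → ∣ σ ∪ ⁅ v ⁆ ∣ ≡ suc ∣ σ ∣
∣∪⁅⁆∣ σ {v} v∉σ = begin
  ∣ σ ∪ ⁅ v ⁆ ∣      ≡⟨ ∣∪∣-disjoint σ ⁅ v ⁆ (disjoint-⁅⁆ σ v∉σ) ⟩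
  ∣ σ ∣ ℕ.+ ∣ ⁅ v ⁆ ∣ ≡⟨ cong (∣ σ ∣ ℕ.+_) (∣⁅x⁆∣≡1 v) ⟩
  ∣ σ ∣ ℕ.+ 1        ≡⟨ ℕ.+-comm ∣ σ ∣ 1 ⟩
  suc ∣ σ ∣          ∎
  where open ≡-Reasoning

∈ᵇ-─⁺ : ∀ {n} {A B : Subset n} {v} → v ∈ᵇ A ≡ true → v ∈ᵇ B ≡ false → v ∈ᵇ A ─ B ≡ true
∈ᵇ-─⁺ {A = A} {B} {v} v∈A v∉B = trans (∈ᵇ-─ A B v) (∧-intro v∈A (not-false v∉B))

∈ᵇ-─⁻ : ∀ {n} {A B : Subset n} {v} → v ∈ᵇ A ─ B ≡ true → v ∈ᵇ A ≡ true × v ∈ᵇ B ≡ false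
∈ᵇ-─⁻ {A = A} {B} {v} v∈A─B =
  ∧-conicalˡ (v ∈ᵇ A) _ v∈A─B′ , not-true (∧-conicalʳ (v ∈ᵇ A) _ v∈A─B′)
  where v∈A─B′ = trans (sym (∈ᵇ-─ A B v)) v∈A─B

⊆ᵇ-⊤ : ∀ {n} (σ : Subset n) → σ ⊆ᵇ ∁ ⊥ ≡ true
⊆ᵇ-⊤ σ = ⊆ᵇ⁺ σ (∁ ⊥) (λ v _ → trans (∈ᵇ-∁ ⊥ v) (cong not (∈ᵇ-⊥ v)))

=ᵇ-refl : ∀ {n} (A : Subset n) → A =ᵇ A ≡ true
=ᵇ-refl A = ∧-intro A⊆A A⊆A
  where A⊆A = ⊆ᵇ⁺ A A (λ _ v∈A → v∈A)

=ᵇ⇒≡ : ∀ {n} (A B : Subset n) → A =ᵇ B ≡ true → A ≡ B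
=ᵇ⇒≡ A B A=B = subset-ext A B λ v →
  bool-ext (⊆ᵇ⇒ A B (∧-conicalˡ (A ⊆ᵇ B) _ A=B) v) (⊆ᵇ⇒ B A (∧-conicalʳ (A ⊆ᵇ B) _ A=B) v)

⊆ᵇ⇒⊆ : ∀ {n} (A B : Subset n) → A ⊆ᵇ B ≡ true → A ⊆ B
⊆ᵇ⇒⊆ A B A⊆B {v} v∈A = lookup⇒[]= v B (⊆ᵇ⇒ A B A⊆B v ([]=⇒lookup v∈A))

⊂ᵇ⇒∣∣< : ∀ {n} (A B : Subset n) → A ⊂ᵇ B ≡ true → ∣ A ∣ ℕ.< ∣ B ∣
⊂ᵇ⇒∣∣< A B A⊂B with v , v∈B , v∉A ← ⊆ᵇ-witness {A = B} {A} (not-true (∧-conicalʳ (A ⊆ᵇ B) _ A⊂B)) =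
  p⊂q⇒∣p∣<∣q∣ (⊆ᵇ⇒⊆ A B (∧-conicalˡ (A ⊆ᵇ B) _ A⊂B) ,
                v , lookup⇒[]= v B v∈B , λ v∈A → true≢false ([]=⇒lookup v∈A) v∉A)

∈ᵇ⇒∣∣≥1 : ∀ {n} (A : Subset n) {v} → v ∈ᵇ A ≡ true → 1 ℕ.≤ ∣ A ∣
∈ᵇ⇒∣∣≥1 (true  ∷ A) {zero}  _   = ℕ.s≤s ℕ.z≤n
∈ᵇ⇒∣∣≥1 (true  ∷ A) {suc v} _   = ℕ.s≤s ℕ.z≤n
∈ᵇ⇒∣∣≥1 (false ∷ A) {suc v} v∈A = ∈ᵇ⇒∣∣≥1 A v∈A

∈ᵇ⇒∣∣≥2 : ∀ {n} (A : Subset n) {u v} → u ∈ᵇ A ≡ true → v ∈ᵇ A ≡ true → u ≢ v → 2 ℕ.≤ ∣ A ∣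
∈ᵇ⇒∣∣≥2 (_     ∷ A) {zero}  {zero}  _   _   u≢v = ⊥-elim (u≢v refl)
∈ᵇ⇒∣∣≥2 (true  ∷ A) {zero}  {suc v} _   v∈A _   = ℕ.s≤s (∈ᵇ⇒∣∣≥1 A v∈A)
∈ᵇ⇒∣∣≥2 (true  ∷ A) {suc u} {_}     u∈A _   _   = ℕ.s≤s (∈ᵇ⇒∣∣≥1 A u∈A)
∈ᵇ⇒∣∣≥2 (false ∷ A) {suc u} {suc v} u∈A v∈A u≢v = ∈ᵇ⇒∣∣≥2 A u∈A v∈A (λ u≡v → u≢v (cong suc u≡v))

∣∣≡1⇒unique : ∀ {n} (A : Subset n) {u v} → ∣ A ∣ ≡ 1 → u ∈ᵇ A ≡ true → v ∈ᵇ A ≡ true → u ≡ v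
∣∣≡1⇒unique A {u} {v} ∣A∣≡1 u∈A v∈A with u ≟ v
... | yes u≡v = u≡v
... | no  u≢v with ℕ.s≤s () ← subst (2 ℕ.≤_) ∣A∣≡1 (∈ᵇ⇒∣∣≥2 A u∈A v∈A u≢v)

∣∣≡0 : ∀ {n} (A : Subset n) → (∀ v → v ∈ᵇ A ≡ false) → ∣ A ∣ ≡ 0
∣∣≡0 []          _ = refl
∣∣≡0 (true  ∷ A) h with () ← h zero
∣∣≡0 (false ∷ A) h = ∣∣≡0 A (λ v → h (suc v))

countBelow-∪ : ∀ {n} (p q : Subset n) → Disjoint p q →
  ∀ w → countBelow (p ∪ q) w ≡ countBelow p w ℕ.+ countBelow q w
countBelow-∪ (x     ∷ p) (y     ∷ q) d zero    = refl
countBelow-∪ (true  ∷ p) (true  ∷ q) d (suc w) with () ← d zero refl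
countBelow-∪ (true  ∷ p) (false ∷ q) d (suc w) = cong suc (countBelow-∪ p q (λ v → d (suc v)) w)
countBelow-∪ (false ∷ p) (true  ∷ q) d (suc w) =
  trans (cong suc (countBelow-∪ p q (λ v → d (suc v)) w))
        (sym (ℕ.+-suc (countBelow p w) (countBelow q w)))
countBelow-∪ (false ∷ p) (false ∷ q) d (suc w) = countBelow-∪ p q (λ v → d (suc v)) w

countBelow-⊥ : ∀ {n} (w : Fin n) → countBelow ⊥ w ≡ 0
countBelow-⊥ zero    = refl
countBelow-⊥ (suc w) = countBelow-⊥ w

countBelow-⁅⁆-trichotomy : ∀ {n} {v w : Fin n} → v ≢ w →
  countBelow ⁅ v ⁆ w ℕ.+ countBelow ⁅ w ⁆ v ≡ 1
countBelow-⁅⁆-trichotomy {v = zero}  {zero}  v≢w = ⊥-elim (v≢w refl)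
countBelow-⁅⁆-trichotomy {v = zero}  {suc w} v≢w = cong suc (trans (ℕ.+-identityʳ _) (countBelow-⊥ w))
countBelow-⁅⁆-trichotomy {v = suc v} {zero}  v≢w = cong suc (countBelow-⊥ v)
countBelow-⁅⁆-trichotomy {v = suc v} {suc w} v≢w =
  countBelow-⁅⁆-trichotomy (λ v≡w → v≢w (cong suc v≡w))

sgn-+ : ∀ a b → sgn (a ℕ.+ b) ≡ sgn a * sgn b
sgn-+ zero    b = sym (ℤ.*-identityˡ (sgn b))
sgn-+ (suc a) b = trans (cong -_ (sgn-+ a b)) (ℤ.neg-distribˡ-* (sgn a) (sgn b))

sgn-*-sgn : ∀ a → sgn a * sgn a ≡ 1ℤ
sgn-*-sgn a = trans (sym (sgn-+ a a)) (sgn-even a)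
  where
  sgn-even : ∀ a → sgn (a ℕ.+ a) ≡ 1ℤ
  sgn-even zero    = refl
  sgn-even (suc a) = trans (cong (λ k → - sgn k) (ℕ.+-suc a a))
                           (trans (ℤ.neg-involutive _) (sgn-even a))

sgn-*-sgn-* : ∀ a x → sgn a * (sgn a * x) ≡ x
sgn-*-sgn-* a x =
  trans (sym (ℤ.*-assoc (sgn a) (sgn a) x)) (trans (cong (_* x) (sgn-*-sgn a)) (ℤ.*-identityˡ x))

sgn-flip : ∀ m {c c'} → c ℕ.+ c' ≡ 1 → sgn (m ℕ.+ c) ≡ - sgn (m ℕ.+ c')
sgn-flip m {0} {1} refl = begin
  sgn (m ℕ.+ 0)     ≡⟨ cong sgn (ℕ.+-identityʳ m) ⟩
  sgn m             ≡⟨ ℤ.neg-involutive (sgn m) ⟨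
  - - sgn m         ≡⟨ cong (λ k → - sgn k) (ℕ.+-comm 1 m) ⟩
  - sgn (m ℕ.+ 1)   ∎
  where open ≡-Reasoning
sgn-flip m {1} {0} refl = begin
  sgn (m ℕ.+ 1)     ≡⟨ cong sgn (ℕ.+-comm m 1) ⟩
  - sgn m           ≡⟨ cong (λ k → - sgn k) (ℕ.+-identityʳ m) ⟨
  - sgn (m ℕ.+ 0)   ∎
  where open ≡-Reasoning

-- The boundary operator

sumFin-cong : ∀ {n} {f g : Fin n → ℤ} → (∀ v → f v ≡ g v) → sumFin f ≡ sumFin g
sumFin-cong {zero}  h = refl
sumFin-cong {suc n} h = cong₂ _+_ (h zero) (sumFin-cong (λ v → h (suc v)))

sumFin-zero : ∀ {n} {f : Fin n → ℤ} → (∀ v → f v ≡ 0ℤ) → sumFin f ≡ 0ℤ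
sumFin-zero {zero}  h = refl
sumFin-zero {suc n} h = cong₂ _+_ (h zero) (sumFin-zero (λ v → h (suc v)))

sumFin-+ : ∀ {n} (f g : Fin n → ℤ) → sumFin (λ v → f v + g v) ≡ sumFin f + sumFin g
sumFin-+ {zero}  f g = refl
sumFin-+ {suc n} f g =
  trans (cong (_+_ (f zero + g zero)) (sumFin-+ (λ v → f (suc v)) (λ v → g (suc v))))
        (+-interchange (f zero) (g zero) _ _)
  where
  +-interchange : ∀ a b c d → a + b + (c + d) ≡ a + c + (b + d)
  +-interchange = solve-∀

sumFin-* : ∀ {n} c (f : Fin n → ℤ) → sumFin (λ v → c * f v) ≡ c * sumFin f
sumFin-* {zero}  c f = sym (ℤ.*-zeroʳ c)
sumFin-* {suc n} c f = trans (cong (_+_ (c * f zero)) (sumFin-* c (λ v → f (suc v))))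
                             (sym (ℤ.*-distribˡ-+ c (f zero) _))

sumFin-neg : ∀ {n} (f : Fin n → ℤ) → sumFin (λ v → - f v) ≡ - sumFin f
sumFin-neg {zero}  f = refl
sumFin-neg {suc n} f = trans (cong (_+_ (- f zero)) (sumFin-neg (λ v → f (suc v))))
                             (sym (ℤ.neg-distrib-+ (f zero) _))

sumFin-swap : ∀ {m n} (G : Fin m → Fin n → ℤ) →
  sumFin (λ v → sumFin (G v)) ≡ sumFin (λ w → sumFin (λ v → G v w))
sumFin-swap {zero} {n} G = sym (sumFin-zero {n} (λ _ → refl))
sumFin-swap {suc m} G = trans (cong (_+_ (sumFin (G zero))) (sumFin-swap (λ v → G (suc v))))
                              (sym (sumFin-+ (G zero) _))

∂-term : ∀ {n} → Complex n → Chain n → Subset n → Fin n → ℤ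
∂-term Δ f σ v =
  if not (v ∈ᵇ σ) ∧ Δ (σ ∪ ⁅ v ⁆) then sgn (countBelow σ v) * f (σ ∪ ⁅ v ⁆) else 0ℤ

∂-term-coface : ∀ {n} Δ (f : Chain n) σ v → v ∈ᵇ σ ≡ false → Δ (σ ∪ ⁅ v ⁆) ≡ true →
  ∂-term Δ f σ v ≡ sgn (countBelow σ v) * f (σ ∪ ⁅ v ⁆)
∂-term-coface Δ f σ v v∉σ coface rewrite v∉σ | coface = refl

CofacesAgree : ∀ {n} → Complex n → Chain n → Chain n → Subset n → Fin n → Set
CofacesAgree Δ f g σ v = v ∈ᵇ σ ≡ false → Δ (σ ∪ ⁅ v ⁆) ≡ true → f (σ ∪ ⁅ v ⁆) ≡ g (σ ∪ ⁅ v ⁆)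

∂-term-cong : ∀ {n} Δ (f g : Chain n) σ v → CofacesAgree Δ f g σ v → ∂-term Δ f σ v ≡ ∂-term Δ g σ v
∂-term-cong Δ f g σ v agree with v ∈ᵇ σ | Δ (σ ∪ ⁅ v ⁆)
... | true  | _     = refl
... | false | false = refl
... | false | true  = cong (sgn (countBelow σ v) *_) (agree refl refl)

∂-term-zero : ∀ {n} Δ (f : Chain n) σ v → CofacesAgree Δ f (λ _ → 0ℤ) σ v → ∂-term Δ f σ v ≡ 0ℤ
∂-term-zero Δ f σ v agree =
  trans (∂-term-cong Δ f (λ _ → 0ℤ) σ v agree) (zero-term (not (v ∈ᵇ σ) ∧ Δ (σ ∪ ⁅ v ⁆)))
  where
  zero-term : ∀ b → (if b then sgn (countBelow σ v) * 0ℤ else 0ℤ) ≡ 0ℤ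
  zero-term true  = ℤ.*-zeroʳ (sgn (countBelow σ v))
  zero-term false = refl

∂-cong : ∀ {n} Δ (f g : Chain n) σ → (∀ v → CofacesAgree Δ f g σ v) → ∂ Δ f σ ≡ ∂ Δ g σ
∂-cong Δ f g σ agree = sumFin-cong (λ v → ∂-term-cong Δ f g σ v (agree v))

∂-zero : ∀ {n} Δ (f : Chain n) σ → (∀ v → CofacesAgree Δ f (λ _ → 0ℤ) σ v) → ∂ Δ f σ ≡ 0ℤ
∂-zero Δ f σ agree = sumFin-zero (λ v → ∂-term-zero Δ f σ v (agree v))

∂-+ : ∀ {n} Δ (f g : Chain n) σ → ∂ Δ (λ τ → f τ + g τ) σ ≡ ∂ Δ f σ + ∂ Δ g σ
∂-+ Δ f g σ = trans (sumFin-cong term-+) (sumFin-+ (∂-term Δ f σ) (∂-term Δ g σ))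
  where
  term-+ : ∀ v → ∂-term Δ (λ τ → f τ + g τ) σ v ≡ ∂-term Δ f σ v + ∂-term Δ g σ v
  term-+ v with not (v ∈ᵇ σ) ∧ Δ (σ ∪ ⁅ v ⁆)
  ... | true  = ℤ.*-distribˡ-+ (sgn (countBelow σ v)) _ _
  ... | false = refl

∂-neg : ∀ {n} Δ (f : Chain n) σ → ∂ Δ (λ τ → - f τ) σ ≡ - ∂ Δ f σ
∂-neg Δ f σ = trans (sumFin-cong term-neg) (sumFin-neg (∂-term Δ f σ))
  where
  term-neg : ∀ v → ∂-term Δ (λ τ → - f τ) σ v ≡ - ∂-term Δ f σ v
  term-neg v with not (v ∈ᵇ σ) ∧ Δ (σ ∪ ⁅ v ⁆)
  ... | true  = sym (ℤ.neg-distribʳ-* (sgn (countBelow σ v)) _)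
  ... | false = refl

∂-− : ∀ {n} Δ (f g : Chain n) σ → ∂ Δ (λ τ → f τ - g τ) σ ≡ ∂ Δ f σ - ∂ Δ g σ
∂-− Δ f g σ = trans (∂-+ Δ f (λ τ → - g τ) σ) (cong (_+_ (∂ Δ f σ)) (∂-neg Δ g σ))

DownwardClosed : ∀ {n} → Complex n → Set
DownwardClosed Δ = ∀ σ v → Δ (σ ∪ ⁅ v ⁆) ≡ true → Δ σ ≡ true

∂-nonface : ∀ {n} {Δ} → DownwardClosed Δ → ∀ (f : Chain n) σ → Δ σ ≡ false → ∂ Δ f σ ≡ 0ℤ
∂-nonface {Δ = Δ} closed f σ nonface =
  ∂-zero Δ f σ (λ v _ coface → true≢false (closed σ v coface) nonface)

restrict : ∀ {n} → Complex n → Chain n → Chain n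
restrict K f τ = if K τ then f τ else 0ℤ

∂-restrict : ∀ {n} {K K' : Complex n} → (∀ τ → K τ ≡ true → K' τ ≡ true) →
  ∀ f σ → ∂ K f σ ≡ ∂ K' (restrict K f) σ
∂-restrict {K = K} {K'} K⊆K' f σ = sumFin-cong term
  where
  term : ∀ v → ∂-term K f σ v ≡ ∂-term K' (restrict K f) σ v
  term v with v ∈ᵇ σ | K (σ ∪ ⁅ v ⁆) in coface
  ... | true  | _     = refl
  ... | false | true  rewrite K⊆K' _ coface = refl
  ... | false | false with K' (σ ∪ ⁅ v ⁆)
  ...   | true  = sym (ℤ.*-zeroʳ (sgn (countBelow σ v)))
  ...   | false = refl

∂-term-sumFin : ∀ {n} Δ (h : Subset n → Fin n → ℤ) σ v →
  ∂-term Δ (λ τ → sumFin (h τ)) σ v ≡ sumFin (λ w → ∂-term Δ (λ τ → h τ w) σ v)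
∂-term-sumFin {n} Δ h σ v with not (v ∈ᵇ σ) ∧ Δ (σ ∪ ⁅ v ⁆)
... | true  = sym (sumFin-* (sgn (countBelow σ v)) (h (σ ∪ ⁅ v ⁆)))
... | false = sym (sumFin-zero {n} {λ _ → 0ℤ} (λ _ → refl))

x≡-x⇒x≡0 : ∀ {x} → x ≡ - x → x ≡ 0ℤ
x≡-x⇒x≡0 {+ zero} _ = refl

module _ {n} {Δ : Complex n} (closed : DownwardClosed Δ) (f : Chain n) (σ : Subset n) where

  private
    ∂∂-term : Fin n → Fin n → ℤ
    ∂∂-term v w = ∂-term Δ (λ τ → ∂-term Δ f τ w) σ v

    ∂∂-term-∈ : ∀ {v w} → v ∈ᵇ σ ≡ true → ∂∂-term v w ≡ 0ℤ
    ∂∂-term-∈ {v} {w} v∈σ = ∂-term-zero Δ (λ τ → ∂-term Δ f τ w) σ v (λ v∉σ _ → true≢false v∈σ v∉σ)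

    ∂∂-term-∈′ : ∀ {v w} → w ∈ᵇ σ ∪ ⁅ v ⁆ ≡ true → ∂∂-term v w ≡ 0ℤ
    ∂∂-term-∈′ {v} {w} w∈σv = ∂-term-zero Δ (λ τ → ∂-term Δ f τ w) σ v (λ _ _ →
      ∂-term-zero Δ f (σ ∪ ⁅ v ⁆) w (λ w∉σv _ → true≢false w∈σv w∉σv))

    ∂∂-term-nonface : ∀ {v w} → Δ ((σ ∪ ⁅ v ⁆) ∪ ⁅ w ⁆) ≡ false → ∂∂-term v w ≡ 0ℤ
    ∂∂-term-nonface {v} {w} nonface = ∂-term-zero Δ (λ τ → ∂-term Δ f τ w) σ v (λ _ _ →
      ∂-term-zero Δ f (σ ∪ ⁅ v ⁆) w (λ _ face → true≢false face nonface))

    ∂∂-term-face : ∀ {v w} → v ∈ᵇ σ ≡ false → w ∈ᵇ σ ≡ false → v ≢ w →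
      Δ ((σ ∪ ⁅ v ⁆) ∪ ⁅ w ⁆) ≡ true →
      ∂∂-term v w ≡ sgn (countBelow σ v ℕ.+ countBelow σ w ℕ.+ countBelow ⁅ v ⁆ w) * f ((σ ∪ ⁅ v ⁆) ∪ ⁅ w ⁆)
    ∂∂-term-face {v} {w} v∉σ w∉σ v≢w face = begin
      ∂∂-term v w
        ≡⟨ ∂-term-coface Δ (λ τ → ∂-term Δ f τ w) σ v v∉σ (closed _ w face) ⟩
      sgn (countBelow σ v) * ∂-term Δ f (σ ∪ ⁅ v ⁆) w
        ≡⟨ cong (sgn (countBelow σ v) *_)
                (∂-term-coface Δ f _ w (∪-avoid σ ⁅ v ⁆ w∉σ (∈ᵇ-⁅⁆-≢ v≢w)) face) ⟩
      sgn (countBelow σ v) * (sgn (countBelow (σ ∪ ⁅ v ⁆) w) * τ′)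
        ≡⟨ ℤ.*-assoc (sgn (countBelow σ v)) _ τ′ ⟨
      sgn (countBelow σ v) * sgn (countBelow (σ ∪ ⁅ v ⁆) w) * τ′
        ≡⟨ cong (_* τ′) (sgn-+ (countBelow σ v) _) ⟨
      sgn (countBelow σ v ℕ.+ countBelow (σ ∪ ⁅ v ⁆) w) * τ′
        ≡⟨ cong (λ k → sgn (countBelow σ v ℕ.+ k) * τ′)
                (countBelow-∪ σ ⁅ v ⁆ (disjoint-⁅⁆ σ v∉σ) w) ⟩
      sgn (countBelow σ v ℕ.+ (countBelow σ w ℕ.+ countBelow ⁅ v ⁆ w)) * τ′
        ≡⟨ cong (λ k → sgn k * τ′) (ℕ.+-assoc (countBelow σ v) _ _) ⟨
      sgn (countBelow σ v ℕ.+ countBelow σ w ℕ.+ countBelow ⁅ v ⁆ w) * τ′ ∎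
      where
      open ≡-Reasoning
      τ′ = f ((σ ∪ ⁅ v ⁆) ∪ ⁅ w ⁆)

    -- The two orders of adding v and w to σ differ by exactly one transposition.
    ∂∂-term-antisym-fresh : ∀ {v w} → v ∈ᵇ σ ≡ false → w ∈ᵇ σ ≡ false → v ≢ w →
      ∂∂-term v w ≡ - ∂∂-term w v
    ∂∂-term-antisym-fresh {v} {w} v∉σ w∉σ v≢w = case-bool (Δ ((σ ∪ ⁅ v ⁆) ∪ ⁅ w ⁆)) face nonface
      where
      swap-face : ∀ {b} → Δ ((σ ∪ ⁅ v ⁆) ∪ ⁅ w ⁆) ≡ b → Δ ((σ ∪ ⁅ w ⁆) ∪ ⁅ v ⁆) ≡ b
      swap-face = trans (cong Δ (∪-swap σ ⁅ w ⁆ ⁅ v ⁆))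
      nonface : Δ ((σ ∪ ⁅ v ⁆) ∪ ⁅ w ⁆) ≡ false → ∂∂-term v w ≡ - ∂∂-term w v
      nonface e = trans (∂∂-term-nonface e) (sym (cong -_ (∂∂-term-nonface (swap-face e))))
      face : Δ ((σ ∪ ⁅ v ⁆) ∪ ⁅ w ⁆) ≡ true → ∂∂-term v w ≡ - ∂∂-term w v
      face e = begin
        ∂∂-term v w
          ≡⟨ ∂∂-term-face v∉σ w∉σ v≢w e ⟩
        sgn (cv ℕ.+ cw ℕ.+ countBelow ⁅ v ⁆ w) * τ′
          ≡⟨ cong (_* τ′) (sgn-flip (cv ℕ.+ cw) (countBelow-⁅⁆-trichotomy v≢w)) ⟩
        - sgn (cv ℕ.+ cw ℕ.+ countBelow ⁅ w ⁆ v) * τ′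
          ≡⟨ ℤ.neg-distribˡ-* (sgn (cv ℕ.+ cw ℕ.+ countBelow ⁅ w ⁆ v)) τ′ ⟨
        - (sgn (cv ℕ.+ cw ℕ.+ countBelow ⁅ w ⁆ v) * τ′)
          ≡⟨ cong₂ (λ k τ → - (sgn (k ℕ.+ countBelow ⁅ w ⁆ v) * f τ))
                   (ℕ.+-comm cv cw) (∪-swap σ ⁅ v ⁆ ⁅ w ⁆) ⟩
        - (sgn (cw ℕ.+ cv ℕ.+ countBelow ⁅ w ⁆ v) * f ((σ ∪ ⁅ w ⁆) ∪ ⁅ v ⁆))
          ≡⟨ cong -_ (∂∂-term-face w∉σ v∉σ (λ w≡v → v≢w (sym w≡v)) (swap-face e)) ⟨
        - ∂∂-term w v ∎
        where
        open ≡-Reasoning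
        cv = countBelow σ v
        cw = countBelow σ w
        τ′ = f ((σ ∪ ⁅ v ⁆) ∪ ⁅ w ⁆)

    ∂∂-term-antisym : ∀ v w → ∂∂-term v w ≡ - ∂∂-term w v
    ∂∂-term-antisym v w = case-bool (v ∈ᵇ σ)
      (λ v∈σ → trans (∂∂-term-∈ v∈σ) (sym (cong -_ (∂∂-term-∈′ (∪-keepˡ σ ⁅ w ⁆ v∈σ)))))
      (λ v∉σ → case-bool (w ∈ᵇ σ)
        (λ w∈σ → trans (∂∂-term-∈′ (∪-keepˡ σ ⁅ v ⁆ w∈σ)) (sym (cong -_ (∂∂-term-∈ w∈σ))))
        (λ w∉σ → fresh v∉σ w∉σ (v ≟ w)))
      where
      fresh : v ∈ᵇ σ ≡ false → w ∈ᵇ σ ≡ false → Dec (v ≡ w) → ∂∂-term v w ≡ - ∂∂-term w v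
      fresh _   _   (yes refl) = trans (∂∂-term-∈′ (∪⁅⁆-new σ v)) (sym (cong -_ (∂∂-term-∈′ (∪⁅⁆-new σ v))))
      fresh v∉σ w∉σ (no v≢w)   = ∂∂-term-antisym-fresh v∉σ w∉σ v≢w

    ∂∂-sum : ℤ
    ∂∂-sum = sumFin (λ v → sumFin (∂∂-term v))

    ∂∂-sum-neg : ∂∂-sum ≡ - ∂∂-sum
    ∂∂-sum-neg = begin
      ∂∂-sum                                         ≡⟨ sumFin-swap ∂∂-term ⟩
      sumFin (λ w → sumFin (λ v → ∂∂-term v w))      ≡⟨ sumFin-cong (λ w → sumFin-cong (λ v → ∂∂-term-antisym v w)) ⟩
      sumFin (λ w → sumFin (λ v → - ∂∂-term w v))    ≡⟨ sumFin-cong (λ w → sumFin-neg (∂∂-term w)) ⟩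
      sumFin (λ w → - sumFin (∂∂-term w))            ≡⟨ sumFin-neg (λ w → sumFin (∂∂-term w)) ⟩
      - ∂∂-sum                                       ∎
      where open ≡-Reasoning

  ∂∘∂≡0 : ∂ Δ (∂ Δ f) σ ≡ 0ℤ
  ∂∘∂≡0 = x≡-x⇒x≡0 (subst (λ x → x ≡ - x) (sym ∂∂-expand) ∂∂-sum-neg)
    where
    ∂∂-expand : ∂ Δ (∂ Δ f) σ ≡ ∂∂-sum
    ∂∂-expand = sumFin-cong (∂-term-sumFin Δ (∂-term Δ f) σ)

neg-from-sum : ∀ {a b c} → a + b ≡ c → - a ≡ b - c
neg-from-sum {a} {b} refl = neg≡−− a b
  where
  neg≡−− : ∀ a b → - a ≡ b - (a + b)
  neg≡−− = solve-∀

EqOn : ∀ {n} → Complex n → ℤ → Chain n → Chain n → Set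
EqOn Δ i f g = ∀ σ → IsDimFace Δ i σ → f σ ≡ g σ

EqOn-reindex : ∀ {n} {Δ : Complex n} {i j f g} → i ≡ j → EqOn Δ i f g → EqOn Δ j f g
EqOn-reindex refl eq = eq

vanishing⇒boundary : ∀ {n} {Δ : Complex n} {i f} → EqOn Δ i f (λ _ → 0ℤ) → IsBoundary Δ i f
vanishing⇒boundary {Δ = Δ} vanish =
  (λ _ → 0ℤ) , λ σ face → trans (∂-zero Δ (λ _ → 0ℤ) σ (λ _ _ _ → refl)) (sym (vanish σ face))

∣∪⁅⁆∣-dim : ∀ {n} {σ : Subset n} {v} j → + ∣ σ ∣ ≡ (j - 1ℤ) + 1ℤ → v ∈ᵇ σ ≡ false →
  + ∣ σ ∪ ⁅ v ⁆ ∣ ≡ j + 1ℤ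
∣∪⁅⁆∣-dim {σ = σ} j dim v∉σ =
  trans (cong +_ (∣∪⁅⁆∣ σ v∉σ)) (trans (ℤ.pos-+ 1 ∣ σ ∣) (trans (cong (_+_ 1ℤ) dim) (shift j)))
  where
  shift : ∀ j → 1ℤ + ((j - 1ℤ) + 1ℤ) ≡ j + 1ℤ
  shift = solve-∀

∂-local : ∀ {n} {Δ : Complex n} {j f g} → EqOn Δ j f g →
  ∀ σ → + ∣ σ ∣ ≡ (j - 1ℤ) + 1ℤ → ∂ Δ f σ ≡ ∂ Δ g σ
∂-local {Δ = Δ} {j} {f} {g} eq σ dim =
  ∂-cong Δ f g σ (λ v v∉σ coface → eq (σ ∪ ⁅ v ⁆) (coface , ∣∪⁅⁆∣-dim {σ = σ} j dim v∉σ))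

record RespectsHomology {n} (Δ : Complex n) (i : ℤ) (Δ' : Complex n) (j : ℤ)
                        (φ : Chain n → Chain n) : Set where
  field
    local    : ∀ {f g} → EqOn Δ i f g → EqOn Δ' j (φ f) (φ g)
    +-hom    : ∀ f g σ → φ (λ τ → f τ + g τ) σ ≡ φ f σ + φ g σ
    −-hom    : ∀ f g σ → φ (λ τ → f τ - g τ) σ ≡ φ f σ - φ g σ
    cycle    : ∀ f → EqOn Δ (i - 1ℤ) (∂ Δ f) (λ _ → 0ℤ) → EqOn Δ' (j - 1ℤ) (∂ Δ' (φ f)) (λ _ → 0ℤ)
    boundary : ∀ h → IsBoundary Δ' j (φ (∂ Δ h))

homologyMap : ∀ {n} {Δ Δ' : Complex n} {i j φ} → RespectsHomology Δ i Δ' j φ → Hom Δ i Δ' j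
homologyMap {Δ = Δ} {Δ'} {i} {j} {φ} resp-φ = record
  { fun      = λ z → record { chain = φ (chain z) ; isCycle = cycle (chain z) (isCycle z) }
  ; resp     = respects-homologous
  ; additive = λ z w s s≈z+w → vanishing⇒boundary {Δ = Δ'} {j} λ σ face →
      trans (cong (_- (φ (chain z) σ + φ (chain w) σ))
                  (trans (local s≈z+w σ face) (+-hom (chain z) (chain w) σ)))
            (ℤ.+-inverseʳ (φ (chain z) σ + φ (chain w) σ))
  }
  where
  open RespectsHomology resp-φ

  respects-homologous : ∀ z w → IsBoundary Δ i (λ σ → chain z σ - chain w σ) →
    IsBoundary Δ' j (λ σ → φ (chain z) σ - φ (chain w) σ)
  respects-homologous z w (h , ∂h≈z−w) with h′ , ∂h′≈φ∂h ← boundary h =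
    h′ , λ σ face → trans (∂h′≈φ∂h σ face)
                          (trans (local ∂h≈z−w σ face) (−-hom (chain z) (chain w) σ))

-- The long exact sequence of a deletion and a link

-- #{(x , u) | x ∈ F, u ∈ τ, x < u}: the number of transpositions that sort the
-- concatenation of τ and F into the face τ ∪ F.
inversions : ∀ {n} → Subset n → Subset n → ℕ
inversions []      []      = 0
inversions (_ ∷ τ) (x ∷ F) = (if x then ∣ τ ∣ else 0) ℕ.+ inversions τ F

inversions-∪⁅⁆ : ∀ {n} (τ F : Subset n) {v} → v ∈ᵇ τ ≡ false →
  inversions (τ ∪ ⁅ v ⁆) F ≡ inversions τ F ℕ.+ countBelow F v
inversions-∪⁅⁆ (_ ∷ τ) (_ ∷ F) {zero} _
  rewrite ∪-identityʳ τ = sym (ℕ.+-identityʳ _)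
inversions-∪⁅⁆ (_ ∷ τ) (false ∷ F) {suc v} v∉τ = inversions-∪⁅⁆ τ F v∉τ
inversions-∪⁅⁆ (_ ∷ τ) (true  ∷ F) {suc v} v∉τ
  rewrite ∣∪⁅⁆∣ τ v∉τ | inversions-∪⁅⁆ τ F v∉τ = regroup ∣ τ ∣ (inversions τ F) (countBelow F v)
  where
  regroup : ∀ a b c → suc (a ℕ.+ (b ℕ.+ c)) ≡ a ℕ.+ b ℕ.+ suc c
  regroup a b c = trans (cong suc (sym (ℕ.+-assoc a b c))) (sym (ℕ.+-suc (a ℕ.+ b) c))

shuffleSign : ∀ {n} → Subset n → Subset n → ℤ
shuffleSign F τ = sgn (inversions τ F)

shuffleSign-∪⁅⁆ : ∀ {n} (F τ : Subset n) {v} → v ∈ᵇ τ ≡ false →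
  shuffleSign F (τ ∪ ⁅ v ⁆) ≡ shuffleSign F τ * sgn (countBelow F v)
shuffleSign-∪⁅⁆ F τ v∉τ = trans (cong sgn (inversions-∪⁅⁆ τ F v∉τ)) (sgn-+ (inversions τ F) _)

⊆ᵇ-∪ʳ : ∀ {n} (ρ F : Subset n) → F ⊆ᵇ (ρ ∪ F) ≡ true
⊆ᵇ-∪ʳ ρ F = ⊆ᵇ⁺ F (ρ ∪ F) (λ v → ∪-keepʳ ρ F)

∪-outside : ∀ {n} (ρ F : Subset n) {v} → v ∈ᵇ F ≡ false → v ∈ᵇ ρ ∪ F ≡ v ∈ᵇ ρ
∪-outside ρ F {v} v∉F = trans (∈ᵇ-∪ ρ F v) (trans (cong ((v ∈ᵇ ρ) ∨_) v∉F) (∨-identityʳ _))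

∪─-cancel : ∀ {n} (ρ F : Subset n) → Disjoint ρ F → (ρ ∪ F) ─ F ≡ ρ
∪─-cancel ρ F disjoint = subset-ext _ _ λ v → begin
  v ∈ᵇ (ρ ∪ F) ─ F             ≡⟨ ∈ᵇ-─ (ρ ∪ F) F v ⟩
  (v ∈ᵇ ρ ∪ F) ∧ not (v ∈ᵇ F)  ≡⟨ case-bool (v ∈ᵇ F) (inside v) (outside v) ⟩
  v ∈ᵇ ρ                       ∎
  where
  open ≡-Reasoning
  inside : ∀ v → v ∈ᵇ F ≡ true → (v ∈ᵇ ρ ∪ F) ∧ not (v ∈ᵇ F) ≡ v ∈ᵇ ρ
  inside v v∈F = case-bool (v ∈ᵇ ρ) (λ v∈ρ → true≢false v∈F (disjoint v v∈ρ))
    (λ v∉ρ → trans (cong (λ b → (v ∈ᵇ ρ ∪ F) ∧ not b) v∈F) (trans (∧-zeroʳ _) (sym v∉ρ)))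
  outside : ∀ v → v ∈ᵇ F ≡ false → (v ∈ᵇ ρ ∪ F) ∧ not (v ∈ᵇ F) ≡ v ∈ᵇ ρ
  outside v v∉F = trans (cong₂ (λ a b → a ∧ not b) (∪-outside ρ F v∉F) v∉F) (∧-identityʳ _)

─∪-cancel : ∀ {n} (σ F : Subset n) → F ⊆ᵇ σ ≡ true → (σ ─ F) ∪ F ≡ σ
─∪-cancel σ F F⊆σ = subset-ext _ _ λ v → case-bool (v ∈ᵇ F)
  (λ v∈F → trans (∪-keepʳ (σ ─ F) F v∈F) (sym (⊆ᵇ⇒ F σ F⊆σ v v∈F)))
  (λ v∉F → trans (∪-outside (σ ─ F) F v∉F)
                 (trans (∈ᵇ-─ σ F v) (trans (cong (λ b → (v ∈ᵇ σ) ∧ not b) v∉F) (∧-identityʳ _))))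

─-disjoint : ∀ {n} (σ F : Subset n) → Disjoint (σ ─ F) F
─-disjoint σ F v v∈σ─F = not-true (∧-conicalʳ (v ∈ᵇ σ) _ (trans (sym (∈ᵇ-─ σ F v)) v∈σ─F))

∪⁅⁆-disjoint : ∀ {n} {ρ F : Subset n} {v} → Disjoint ρ F → v ∈ᵇ F ≡ false → Disjoint (ρ ∪ ⁅ v ⁆) F
∪⁅⁆-disjoint {ρ = ρ} {F} {v} disjoint v∉F w w∈ρv = case-bool (w ∈ᵇ ρ) (disjoint w) λ w∉ρ →
  case-bool (w ∈ᵇ ⁅ v ⁆) (λ w∈v → subst (λ u → u ∈ᵇ F ≡ false) (∈ᵇ-⁅⁆⇒≡ w∈v) v∉F)
    (λ w∉v → true≢false w∈ρv (∪-avoid ρ ⁅ v ⁆ w∉ρ w∉v))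

∣∪∣-dim : ∀ {n} (ρ F : Subset n) → Disjoint ρ F → + ∣ ρ ∪ F ∣ ≡ + ∣ ρ ∣ + + ∣ F ∣
∣∪∣-dim ρ F disjoint = trans (cong +_ (∣∪∣-disjoint ρ F disjoint)) (ℤ.pos-+ ∣ ρ ∣ ∣ F ∣)

record DeletionLink {n} (K K' L : Complex n) (F : Subset n) : Set where
  field
    closed        : DownwardClosed K'
    deletion      : ∀ σ → K σ ≡ K' σ ∧ not (F ⊆ᵇ σ)
    link-disjoint : ∀ τ → L τ ≡ true → Disjoint τ F
    link          : ∀ τ → Disjoint τ F → L τ ≡ K' (τ ∪ F)

module DeletionLinkSequence {n} {K K' L : Complex n} {F : Subset n}
                            (D : DeletionLink K K' L F) where

  open DeletionLink D

  d : ℤ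
  d = + ∣ F ∣

  K⊆K' : ∀ σ → K σ ≡ true → K' σ ≡ true
  K⊆K' σ σ∈K = ∧-conicalˡ (K' σ) _ (trans (sym (deletion σ)) σ∈K)

  K-face⇒F⊈ : ∀ σ → K σ ≡ true → F ⊆ᵇ σ ≡ false
  K-face⇒F⊈ σ σ∈K = not-true (∧-conicalʳ (K' σ) _ (trans (sym (deletion σ)) σ∈K))

  K'∖K⇒F⊆ : ∀ σ → K' σ ≡ true → K σ ≡ false → F ⊆ᵇ σ ≡ true
  K'∖K⇒F⊆ σ σ∈K' σ∉K = case-bool (F ⊆ᵇ σ) (λ F⊆σ → F⊆σ) λ F⊈σ →
    true≢false (trans (deletion σ) (cong₂ _∧_ σ∈K' (not-false F⊈σ))) σ∉K

  K-closed : DownwardClosed K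
  K-closed σ v σv∈K = trans (deletion σ) (∧-intro (closed σ v (K⊆K' _ σv∈K)) (not-false F⊈σ))
    where
    F⊈σ : F ⊆ᵇ σ ≡ false
    F⊈σ = case-bool (F ⊆ᵇ σ) (λ F⊆σ →
      true≢false (⊆ᵇ⁺ F (σ ∪ ⁅ v ⁆) (λ w w∈F → ∪-keepˡ σ ⁅ v ⁆ (⊆ᵇ⇒ F σ F⊆σ w w∈F)))
                 (K-face⇒F⊈ _ σv∈K)) (λ F⊈σ → F⊈σ)

  ∪F∉K : ∀ ρ → K (ρ ∪ F) ≡ false
  ∪F∉K ρ = trans (deletion (ρ ∪ F)) (trans (cong (λ b → K' (ρ ∪ F) ∧ not b) (⊆ᵇ-∪ʳ ρ F)) (∧-zeroʳ _))

  ∪F-face : ∀ {j τ} → IsDimFace L (j - d) τ → IsDimFace K' j (τ ∪ F)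
  ∪F-face {j} {τ} (τ∈L , dim) =
    trans (sym (link τ disjoint)) τ∈L ,
    trans (∣∪∣-dim τ F disjoint) (trans (cong (_+ d) dim) (shift j d))
    where
    disjoint = link-disjoint τ τ∈L
    shift : ∀ j d → j - d + 1ℤ + d ≡ j + 1ℤ
    shift = solve-∀

  ─F-face : ∀ {j σ} → IsDimFace K' j σ → K σ ≡ false → IsDimFace L (j - d) (σ ─ F)
  ─F-face {j} {σ} (σ∈K' , dim) σ∉K =
    trans (link (σ ─ F) (─-disjoint σ F)) (trans (cong K' σ≡) σ∈K') , dim′
    where
    σ≡ = ─∪-cancel σ F (K'∖K⇒F⊆ σ σ∈K' σ∉K)
    unshift : ∀ a d → a ≡ a + d - d
    unshift = solve-∀
    shift : ∀ j d → j + 1ℤ - d ≡ j - d + 1ℤ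
    shift = solve-∀
    open ≡-Reasoning
    dim′ : + ∣ σ ─ F ∣ ≡ j - d + 1ℤ
    dim′ = begin
      + ∣ σ ─ F ∣                ≡⟨ unshift _ d ⟩
      + ∣ σ ─ F ∣ + d - d        ≡⟨ cong (_- d) (∣∪∣-dim (σ ─ F) F (─-disjoint σ F)) ⟨
      + ∣ (σ ─ F) ∪ F ∣ - d      ≡⟨ cong (λ τ → + ∣ τ ∣ - d) σ≡ ⟩
      + ∣ σ ∣ - d                ≡⟨ cong (_- d) dim ⟩
      j + 1ℤ - d                 ≡⟨ shift j d ⟩
      j - d + 1ℤ                 ∎

  ε : Subset n → ℤ
  ε = shuffleSign F

  ε-involutive : ∀ τ x → ε τ * (ε τ * x) ≡ x
  ε-involutive τ = sgn-*-sgn-* (inversions τ F)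

  -- The sign ε makes τ ↦ τ ∪ F commute with the boundary: inserting a vertex v ∉ F
  -- into τ ∪ F costs countBelow (τ ∪ F) v = countBelow τ v + countBelow F v transpositions.
  ∂-∪F : ∀ ρ → Disjoint ρ F → (w g : Chain n) → (∀ τ → L τ ≡ true → w τ ≡ ε τ * g (τ ∪ F)) →
    ∂ L w ρ ≡ ε ρ * ∂ K' g (ρ ∪ F)
  ∂-∪F ρ disjoint w g w≡εg =
    trans (sumFin-cong term) (sumFin-* (ε ρ) (∂-term K' g (ρ ∪ F)))
    where
    both-zero : ∀ v → CofacesAgree L w (λ _ → 0ℤ) ρ v → CofacesAgree K' g (λ _ → 0ℤ) (ρ ∪ F) v →
      ∂-term L w ρ v ≡ ε ρ * ∂-term K' g (ρ ∪ F) v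
    both-zero v w₀ g₀ = trans (∂-term-zero L w ρ v w₀)
      (sym (trans (cong (ε ρ *_) (∂-term-zero K' g (ρ ∪ F) v g₀)) (ℤ.*-zeroʳ (ε ρ))))

    reorder : ∀ s e t x → s * ((e * t) * x) ≡ e * ((s * t) * x)
    reorder = solve-∀

    fresh : ∀ v → v ∈ᵇ F ≡ false → v ∈ᵇ ρ ≡ false → ∂-term L w ρ v ≡ ε ρ * ∂-term K' g (ρ ∪ F) v
    fresh v v∉F v∉ρ = case-bool (L (ρ ∪ ⁅ v ⁆)) coface nonface
      where
      L≡K' : L (ρ ∪ ⁅ v ⁆) ≡ K' ((ρ ∪ F) ∪ ⁅ v ⁆)
      L≡K' = trans (link _ (∪⁅⁆-disjoint {ρ = ρ} {F} disjoint v∉F)) (cong K' (∪-swap ρ ⁅ v ⁆ F))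
      v∉ρF = trans (∪-outside ρ F v∉F) v∉ρ
      nonface : L (ρ ∪ ⁅ v ⁆) ≡ false → ∂-term L w ρ v ≡ ε ρ * ∂-term K' g (ρ ∪ F) v
      nonface ∉L = both-zero v (λ _ ∈L → true≢false ∈L ∉L)
                               (λ _ ∈K' → true≢false (trans L≡K' ∈K') ∉L)
      open ≡-Reasoning
      coface : L (ρ ∪ ⁅ v ⁆) ≡ true → ∂-term L w ρ v ≡ ε ρ * ∂-term K' g (ρ ∪ F) v
      coface ∈L = begin
        ∂-term L w ρ v
          ≡⟨ ∂-term-coface L w ρ v v∉ρ ∈L ⟩
        sgn (countBelow ρ v) * w (ρ ∪ ⁅ v ⁆)
          ≡⟨ cong (sgn (countBelow ρ v) *_) (w≡εg _ ∈L) ⟩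
        sgn (countBelow ρ v) * (ε (ρ ∪ ⁅ v ⁆) * g ((ρ ∪ ⁅ v ⁆) ∪ F))
          ≡⟨ cong (sgn (countBelow ρ v) *_)
                  (cong₂ _*_ (shuffleSign-∪⁅⁆ F ρ v∉ρ) (cong g (∪-swap ρ ⁅ v ⁆ F))) ⟩
        sgn (countBelow ρ v) * (ε ρ * sgn (countBelow F v) * g ((ρ ∪ F) ∪ ⁅ v ⁆))
          ≡⟨ reorder (sgn (countBelow ρ v)) (ε ρ) _ _ ⟩
        ε ρ * (sgn (countBelow ρ v) * sgn (countBelow F v) * g ((ρ ∪ F) ∪ ⁅ v ⁆))
          ≡⟨ cong (λ s → ε ρ * (s * g ((ρ ∪ F) ∪ ⁅ v ⁆)))
                  (trans (sym (sgn-+ (countBelow ρ v) _)) (cong sgn (sym (countBelow-∪ ρ F disjoint v)))) ⟩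
        ε ρ * (sgn (countBelow (ρ ∪ F) v) * g ((ρ ∪ F) ∪ ⁅ v ⁆))
          ≡⟨ cong (ε ρ *_) (∂-term-coface K' g (ρ ∪ F) v v∉ρF (trans (sym L≡K') ∈L)) ⟨
        ε ρ * ∂-term K' g (ρ ∪ F) v ∎

    term : ∀ v → ∂-term L w ρ v ≡ ε ρ * ∂-term K' g (ρ ∪ F) v
    term v = case-bool (v ∈ᵇ F)
      (λ v∈F → both-zero v (λ _ ∈L → true≢false v∈F (link-disjoint _ ∈L v (∪⁅⁆-new ρ v)))
                           (λ v∉ρF _ → true≢false (∪-keepʳ ρ F v∈F) v∉ρF))
      (λ v∉F → case-bool (v ∈ᵇ ρ)
        (λ v∈ρ → both-zero v (λ v∉ρ _ → true≢false v∈ρ v∉ρ)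
                             (λ v∉ρF _ → true≢false (∪-keepˡ ρ F v∈ρ) v∉ρF))
        (fresh v v∉F))

  project : Chain n → Chain n
  project g τ = ε τ * g (τ ∪ F)

  lift : Chain n → Chain n
  lift w σ = if F ⊆ᵇ σ then ε (σ ─ F) * w (σ ─ F) else 0ℤ

  lift-⊇F : ∀ w σ → F ⊆ᵇ σ ≡ true → lift w σ ≡ ε (σ ─ F) * w (σ ─ F)
  lift-⊇F w σ = if-true

  lift-K : ∀ w σ → K σ ≡ true → lift w σ ≡ 0ℤ
  lift-K w σ σ∈K = if-false (K-face⇒F⊈ σ σ∈K)

  project-lift : ∀ w τ → Disjoint τ F → project (lift w) τ ≡ w τ
  project-lift w τ disjoint = begin
    ε τ * lift w (τ ∪ F)                   ≡⟨ cong (ε τ *_) (lift-⊇F w (τ ∪ F) (⊆ᵇ-∪ʳ τ F)) ⟩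
    ε τ * (ε τ′ * w τ′)                    ≡⟨ cong (λ ρ → ε τ * (ε ρ * w ρ)) (∪─-cancel τ F disjoint) ⟩
    ε τ * (ε τ * w τ)                      ≡⟨ ε-involutive τ (w τ) ⟩
    w τ                                    ∎
    where
    open ≡-Reasoning
    τ′ = (τ ∪ F) ─ F

  project-restrict : ∀ g τ → project (restrict K g) τ ≡ 0ℤ
  project-restrict g τ = trans (cong (ε τ *_) (if-false (∪F∉K τ))) (ℤ.*-zeroʳ (ε τ))

  restrict+lift∘project : ∀ g τ → K' τ ≡ true → restrict K g τ + lift (project g) τ ≡ g τ
  restrict+lift∘project g τ τ∈K' = case-bool (K τ) in-K outside-K
    where
    in-K : K τ ≡ true → restrict K g τ + lift (project g) τ ≡ g τ
    in-K τ∈K = trans (cong₂ _+_ (if-true τ∈K) (lift-K (project g) τ τ∈K)) (ℤ.+-identityʳ (g τ))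
    outside-K : K τ ≡ false → restrict K g τ + lift (project g) τ ≡ g τ
    outside-K τ∉K = begin
      restrict K g τ + lift (project g) τ     ≡⟨ cong₂ _+_ (if-false τ∉K) (lift-⊇F (project g) τ F⊆τ) ⟩
      0ℤ + ε (τ ─ F) * project g (τ ─ F)      ≡⟨ ℤ.+-identityˡ _ ⟩
      ε (τ ─ F) * project g (τ ─ F)           ≡⟨ ε-involutive (τ ─ F) _ ⟩
      g ((τ ─ F) ∪ F)                         ≡⟨ cong g (─∪-cancel τ F F⊆τ) ⟩
      g τ                                     ∎
      where
      open ≡-Reasoning
      F⊆τ = K'∖K⇒F⊆ τ τ∈K' τ∉K

  ∂-project : ∀ g τ → Disjoint τ F → ∂ L (project g) τ ≡ project (∂ K' g) τ
  ∂-project g τ disjoint = ∂-∪F τ disjoint (project g) g (λ _ _ → refl)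

  ∂-lift : ∀ w σ → F ⊆ᵇ σ ≡ true → ∂ K' (lift w) σ ≡ lift (∂ L w) σ
  ∂-lift w σ F⊆σ = begin
    ∂ K' (lift w) σ                       ≡⟨ cong (∂ K' (lift w)) (─∪-cancel σ F F⊆σ) ⟨
    ∂ K' (lift w) (ρ ∪ F)                 ≡⟨ ε-involutive ρ _ ⟨
    ε ρ * (ε ρ * ∂ K' (lift w) (ρ ∪ F))   ≡⟨ cong (ε ρ *_) (∂-∪F ρ (─-disjoint σ F) w (lift w) w≡εlift) ⟨
    ε ρ * ∂ L w ρ                         ≡⟨ lift-⊇F (∂ L w) σ F⊆σ ⟨
    lift (∂ L w) σ                        ∎
    where
    open ≡-Reasoning
    ρ = σ ─ F
    w≡εlift : ∀ τ → L τ ≡ true → w τ ≡ ε τ * lift w (τ ∪ F)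
    w≡εlift τ τ∈L = sym (project-lift w τ (link-disjoint τ τ∈L))

  ∂-restrict-commute : ∀ f σ → ∂ K' (restrict K f) σ ≡ restrict K (∂ K f) σ
  ∂-restrict-commute f σ = trans (sym (∂-restrict K⊆K' f σ)) (case-bool (K σ)
    (λ σ∈K → sym (if-true σ∈K))
    (λ σ∉K → trans (∂-nonface K-closed f σ σ∉K) (sym (if-false σ∉K))))

  ∂-restrict+∂-lift∘project : ∀ g σ →
    ∂ K' (restrict K g) σ + ∂ K' (lift (project g)) σ ≡ ∂ K' g σ
  ∂-restrict+∂-lift∘project g σ = trans (sym (∂-+ K' (restrict K g) (lift (project g)) σ))
    (∂-cong K' (λ τ → restrict K g τ + lift (project g) τ) g σ (λ v _ coface → restrict+lift∘project g (σ ∪ ⁅ v ⁆) coface))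

  lift-∂ : ∀ w τ → K' τ ≡ true → lift (∂ L w) τ ≡ ∂ K' (lift w) τ - restrict K (∂ K' (lift w)) τ
  lift-∂ w τ τ∈K' = case-bool (K τ)
    (λ τ∈K → trans (lift-K (∂ L w) τ τ∈K)
                   (sym (trans (cong (_-_ (∂ K' (lift w) τ)) (if-true τ∈K)) (ℤ.+-inverseʳ (∂ K' (lift w) τ)))))
    (λ τ∉K → trans (sym (∂-lift w τ (K'∖K⇒F⊆ τ τ∈K' τ∉K)))
                   (sym (trans (cong (_-_ (∂ K' (lift w) τ)) (if-false τ∉K)) (ℤ.+-identityʳ _))))

  lift-local : ∀ {j f g} → EqOn L (j - d) f g → EqOn K' j (lift f) (lift g)
  lift-local {j} {f} {g} f≈g σ face = case-bool (K σ)
    (λ σ∈K → trans (lift-K f σ σ∈K) (sym (lift-K g σ σ∈K)))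
    (λ σ∉K → let F⊆σ = K'∖K⇒F⊆ σ (proj₁ face) σ∉K in
      trans (lift-⊇F f σ F⊆σ)
            (trans (cong (ε (σ ─ F) *_) (f≈g (σ ─ F) (─F-face {j} face σ∉K))) (sym (lift-⊇F g σ F⊆σ))))

  ∂-lift-vanish : ∀ {j w σ} → EqOn L (j - d) (∂ L w) (λ _ → 0ℤ) → IsDimFace K' j σ → K σ ≡ false →
    ∂ K' (lift w) σ ≡ 0ℤ
  ∂-lift-vanish {j} {w} {σ} cycle face σ∉K = begin
    ∂ K' (lift w) σ          ≡⟨ ∂-lift w σ F⊆σ ⟩
    lift (∂ L w) σ           ≡⟨ lift-⊇F (∂ L w) σ F⊆σ ⟩
    ε ρ * ∂ L w ρ            ≡⟨ cong (ε ρ *_) (cycle ρ (─F-face {j} face σ∉K)) ⟩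
    ε ρ * 0ℤ                 ≡⟨ ℤ.*-zeroʳ (ε ρ) ⟩
    0ℤ                       ∎
    where
    open ≡-Reasoning
    ρ = σ ─ F
    F⊆σ = K'∖K⇒F⊆ σ (proj₁ face) σ∉K

  restrict-+ : ∀ f g σ → restrict K (λ τ → f τ + g τ) σ ≡ restrict K f σ + restrict K g σ
  restrict-+ f g σ with K σ
  ... | true  = refl
  ... | false = refl

  restrict-− : ∀ f g σ → restrict K (λ τ → f τ - g τ) σ ≡ restrict K f σ - restrict K g σ
  restrict-− f g σ with K σ
  ... | true  = refl
  ... | false = refl

  lift-+ : ∀ f g σ → lift (λ τ → f τ + g τ) σ ≡ lift f σ + lift g σ
  lift-+ f g σ with F ⊆ᵇ σ
  ... | true  = ℤ.*-distribˡ-+ (ε (σ ─ F)) (f (σ ─ F)) (g (σ ─ F))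
  ... | false = refl

  lift-− : ∀ f g σ → lift (λ τ → f τ - g τ) σ ≡ lift f σ - lift g σ
  lift-− f g σ with F ⊆ᵇ σ
  ... | true  = *-distribˡ-− (ε (σ ─ F)) (f (σ ─ F)) (g (σ ─ F))
    where
    *-distribˡ-− : ∀ e a b → e * (a - b) ≡ e * a - e * b
    *-distribˡ-− = solve-∀
  ... | false = refl

  pred-shift : ∀ i → i - d - 1ℤ ≡ i - 1ℤ - d
  pred-shift i = shift i d
    where
    shift : ∀ i d → i - d - 1ℤ ≡ i - 1ℤ - d
    shift = solve-∀

  restrict-∂-lift : ∀ {j w} → EqOn L (j - d) (∂ L w) (λ _ → 0ℤ) →
    EqOn K' j (restrict K (∂ K' (lift w))) (∂ K' (lift w))
  restrict-∂-lift {j} {w} w-cycle τ face = case-bool (K τ) if-true λ τ∉K →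
    trans (if-false τ∉K) (sym (∂-lift-vanish {j} {w} w-cycle face τ∉K))

  inclusion : ∀ i → RespectsHomology K i K' i (restrict K)
  inclusion i = record
    { local    = λ {f} {g} f≈g σ face → case-bool (K σ)
        (λ σ∈K → trans (if-true σ∈K) (trans (f≈g σ (σ∈K , proj₂ face)) (sym (if-true σ∈K))))
        (λ σ∉K → trans (if-false σ∉K) (sym (if-false σ∉K)))
    ; +-hom    = restrict-+
    ; −-hom    = restrict-−
    ; cycle    = λ f cycle σ face → trans (∂-restrict-commute f σ) (case-bool (K σ)
        (λ σ∈K → trans (if-true σ∈K) (cycle σ (σ∈K , proj₂ face)))
        (λ σ∉K → if-false σ∉K))
    ; boundary = λ h → restrict K h , λ σ _ → ∂-restrict-commute h σ
    }

  projection : ∀ i → RespectsHomology K' i L (i - d) project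
  projection i = record
    { local    = λ f≈g τ face → cong (ε τ *_) (f≈g (τ ∪ F) (∪F-face {i} face))
    ; +-hom    = λ f g τ → ℤ.*-distribˡ-+ (ε τ) (f (τ ∪ F)) (g (τ ∪ F))
    ; −-hom    = λ f g τ → *-distribˡ-− (ε τ) (f (τ ∪ F)) (g (τ ∪ F))
    ; cycle    = λ f cycle τ face →
        trans (∂-project f τ (link-disjoint τ (proj₁ face)))
              (trans (cong (ε τ *_) (cycle (τ ∪ F) (∪F-face {i - 1ℤ} (subst (λ j → IsDimFace L j τ) (pred-shift i) face))))
                     (ℤ.*-zeroʳ (ε τ)))
    ; boundary = λ h → project h , λ τ face → ∂-project h τ (link-disjoint τ (proj₁ face))
    }
    where
    *-distribˡ-− : ∀ e a b → e * (a - b) ≡ e * a - e * b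
    *-distribˡ-− = solve-∀

  connecting : ∀ i → RespectsHomology L (i - d) K (i - 1ℤ) (λ w → ∂ K' (lift w))
  connecting i = record
    { local    = λ {f} {g} f≈g σ face →
        ∂-local {Δ = K'} {i} {lift f} {lift g} (lift-local {i} f≈g) σ (proj₂ face)
    ; +-hom    = λ f g σ → trans (∂-cong K' (lift (λ τ → f τ + g τ)) (λ τ → lift f τ + lift g τ) σ
                                          (λ v _ _ → lift-+ f g (σ ∪ ⁅ v ⁆)))
                                 (∂-+ K' (lift f) (lift g) σ)
    ; −-hom    = λ f g σ → trans (∂-cong K' (lift (λ τ → f τ - g τ)) (λ τ → lift f τ - lift g τ) σ
                                          (λ v _ _ → lift-− f g (σ ∪ ⁅ v ⁆)))
                                 (∂-− K' (lift f) (lift g) σ)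
    ; cycle    = cycle
    ; boundary = boundary
    }
    where
    cycle : ∀ w → EqOn L (i - d - 1ℤ) (∂ L w) (λ _ → 0ℤ) →
      EqOn K (i - 1ℤ - 1ℤ) (∂ K (∂ K' (lift w))) (λ _ → 0ℤ)
    cycle w w-cycle σ face = begin
      ∂ K (∂ K' (lift w)) σ                  ≡⟨ ∂-restrict K⊆K' (∂ K' (lift w)) σ ⟩
      ∂ K' (restrict K (∂ K' (lift w))) σ    ≡⟨ ∂-local {Δ = K'} {i - 1ℤ} restrict≈ σ (proj₂ face) ⟩
      ∂ K' (∂ K' (lift w)) σ                 ≡⟨ ∂∘∂≡0 closed (lift w) σ ⟩
      0ℤ                                     ∎
      where
      open ≡-Reasoning
      restrict≈ = restrict-∂-lift {i - 1ℤ} {w} (EqOn-reindex (pred-shift i) w-cycle)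

    boundary : ∀ h → IsBoundary K (i - 1ℤ) (∂ K' (lift (∂ L h)))
    boundary h = (λ τ → - ∂lift τ) , λ σ _ → begin
      ∂ K (λ τ → - ∂lift τ) σ
        ≡⟨ ∂-neg K ∂lift σ ⟩
      - ∂ K ∂lift σ
        ≡⟨ ℤ.+-identityˡ (- ∂ K ∂lift σ) ⟨
      0ℤ - ∂ K ∂lift σ
        ≡⟨ cong₂ _-_ (∂∘∂≡0 closed (lift h) σ) (sym (∂-restrict K⊆K' ∂lift σ)) ⟨
      ∂ K' ∂lift σ - ∂ K' (restrict K ∂lift) σ
        ≡⟨ ∂-− K' ∂lift (restrict K ∂lift) σ ⟨
      ∂ K' (λ τ → ∂lift τ - restrict K ∂lift τ) σ
        ≡⟨ ∂-cong K' (lift (∂ L h)) (λ τ → ∂lift τ - restrict K ∂lift τ) σ (λ v _ → lift-∂ h (σ ∪ ⁅ v ⁆)) ⟨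
      ∂ K' (lift (∂ L h)) σ ∎
      where
      open ≡-Reasoning
      ∂lift = ∂ K' (lift h)

  exact-at-K' : ∀ i → Exact (homologyMap (inclusion i)) (homologyMap (projection i))
  exact-at-K' i =
    (λ z → vanishing⇒boundary {Δ = L} {i - d} λ τ _ → project-restrict (chain z) τ) , kernel⊆image
    where
    kernel⊆image : ∀ z′ → IsBoundary L (i - d) (project (chain z′)) →
      Σ (Cycle K i) λ a → Homologous K' i (fun (homologyMap (inclusion i)) a) z′
    kernel⊆image z′ (h , ∂h≈pz′) = a , (λ τ → - lift h τ) , homologous
      where
      a-chain : Chain n
      a-chain σ = chain z′ σ - ∂ K' (lift h) σ

      -- off K, the correction ∂ (lift h) agrees with z′ because ∂ h = project z′
      vanishes-off-K : ∀ σ → IsDimFace K' i σ → K σ ≡ false → a-chain σ ≡ 0ℤ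
      vanishes-off-K σ face σ∉K = begin
        chain z′ σ - ∂ K' (lift h) σ
          ≡⟨ cong (_-_ (chain z′ σ)) (trans (∂-lift h σ F⊆σ) (lift-⊇F (∂ L h) σ F⊆σ)) ⟩
        chain z′ σ - ε ρ * ∂ L h ρ
          ≡⟨ cong (λ x → chain z′ σ - ε ρ * x) (∂h≈pz′ ρ (─F-face {i} face σ∉K)) ⟩
        chain z′ σ - ε ρ * (ε ρ * chain z′ (ρ ∪ F))
          ≡⟨ cong (_-_ (chain z′ σ)) (trans (ε-involutive ρ _) (cong (chain z′) (─∪-cancel σ F F⊆σ))) ⟩
        chain z′ σ - chain z′ σ
          ≡⟨ ℤ.+-inverseʳ (chain z′ σ) ⟩
        0ℤ ∎
        where
        open ≡-Reasoning
        ρ = σ ─ F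
        F⊆σ = K'∖K⇒F⊆ σ (proj₁ face) σ∉K

      restrict≈a : EqOn K' i (restrict K a-chain) a-chain
      restrict≈a σ face = case-bool (K σ) if-true λ σ∉K →
        trans (if-false σ∉K) (sym (vanishes-off-K σ face σ∉K))

      a : Cycle K i
      a = record { chain = a-chain ; isCycle = λ σ face → begin
        ∂ K a-chain σ
          ≡⟨ ∂-restrict K⊆K' a-chain σ ⟩
        ∂ K' (restrict K a-chain) σ
          ≡⟨ ∂-local {Δ = K'} {i} restrict≈a σ (proj₂ face) ⟩
        ∂ K' a-chain σ
          ≡⟨ ∂-− K' (chain z′) (∂ K' (lift h)) σ ⟩
        ∂ K' (chain z′) σ - ∂ K' (∂ K' (lift h)) σ
          ≡⟨ cong₂ _-_ (isCycle z′ σ (K⊆K' σ (proj₁ face) , proj₂ face)) (∂∘∂≡0 closed (lift h) σ) ⟩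
        0ℤ ∎ }
        where open ≡-Reasoning

      homologous : ∀ σ → IsDimFace K' i σ → ∂ K' (λ τ → - lift h τ) σ ≡ restrict K a-chain σ - chain z′ σ
      homologous σ face = begin
        ∂ K' (λ τ → - lift h τ) σ          ≡⟨ ∂-neg K' (lift h) σ ⟩
        - ∂ K' (lift h) σ                  ≡⟨ sub-add-cancel (chain z′ σ) _ ⟩
        a-chain σ - chain z′ σ             ≡⟨ cong (_- chain z′ σ) (restrict≈a σ face) ⟨
        restrict K a-chain σ - chain z′ σ  ∎
        where
        open ≡-Reasoning
        sub-add-cancel : ∀ z x → - x ≡ z - x - z
        sub-add-cancel = solve-∀

  exact-at-L : ∀ i → Exact (homologyMap (projection i)) (homologyMap (connecting i))
  exact-at-L i = composite-vanishes , kernel⊆image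
    where
    composite-vanishes : ∀ z → IsBoundary K (i - 1ℤ) (∂ K' (lift (project (chain z))))
    composite-vanishes z = (λ τ → - chain z τ) , λ σ face → begin
      ∂ K (λ τ → - chain z τ) σ
        ≡⟨ ∂-neg K (chain z) σ ⟩
      - ∂ K (chain z) σ
        ≡⟨ cong -_ (∂-restrict K⊆K' (chain z) σ) ⟩
      - ∂ K' (restrict K (chain z)) σ
        ≡⟨ neg-from-sum (trans (∂-restrict+∂-lift∘project (chain z) σ)
                               (isCycle z σ (K⊆K' σ (proj₁ face) , proj₂ face))) ⟩
      ∂ K' (lift (project (chain z))) σ - 0ℤ
        ≡⟨ ℤ.+-identityʳ _ ⟩
      ∂ K' (lift (project (chain z))) σ ∎
      where open ≡-Reasoning

    kernel⊆image : ∀ w → IsBoundary K (i - 1ℤ) (∂ K' (lift (chain w))) →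
      Σ (Cycle K' i) λ z → Homologous L (i - d) (fun (homologyMap (projection i)) z) w
    kernel⊆image w (h , ∂h≈) = z , vanishing⇒boundary {Δ = L} {i - d} homologous
      where
      z-chain : Chain n
      z-chain τ = lift (chain w) τ - restrict K h τ

      z : Cycle K' i
      z = record { chain = z-chain ; isCycle = λ σ face →
        trans (∂-− K' (lift (chain w)) (restrict K h) σ)
              (trans (cong (_-_ (∂ K' (lift (chain w)) σ)) (∂-restrict-commute h σ)) (case-bool (K σ)
                (λ σ∈K → trans (cong₂ _-_ (sym (∂h≈ σ (σ∈K , proj₂ face))) (if-true σ∈K))
                               (ℤ.+-inverseʳ (∂ K h σ)))
                (λ σ∉K → cong₂ _-_ (∂-lift-vanish {i - 1ℤ} {chain w} (EqOn-reindex (pred-shift i) (isCycle w)) face σ∉K)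
                                   (if-false σ∉K)))) }

      homologous : ∀ τ → IsDimFace L (i - d) τ → project z-chain τ - chain w τ ≡ 0ℤ
      homologous τ face = begin
        project z-chain τ - chain w τ
          ≡⟨ cong (_- chain w τ) (RespectsHomology.−-hom (projection i) (lift (chain w)) (restrict K h) τ) ⟩
        project (lift (chain w)) τ - project (restrict K h) τ - chain w τ
          ≡⟨ cong₂ (λ x y → x - y - chain w τ) (project-lift (chain w) τ (link-disjoint τ (proj₁ face)))
                                               (project-restrict h τ) ⟩
        chain w τ - 0ℤ - chain w τ
          ≡⟨ cancel (chain w τ) ⟩
        0ℤ ∎
        where
        open ≡-Reasoning
        cancel : ∀ x → x - 0ℤ - x ≡ 0ℤ
        cancel = solve-∀

  exact-at-K : ∀ i → Exact (homologyMap (connecting i)) (homologyMap (inclusion (i - 1ℤ)))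
  exact-at-K i = composite-vanishes , kernel⊆image
    where
    composite-vanishes : ∀ w → IsBoundary K' (i - 1ℤ) (restrict K (∂ K' (lift (chain w))))
    composite-vanishes w =
      lift (chain w) , λ σ face → sym (restrict-∂-lift {i - 1ℤ} {chain w} (EqOn-reindex (pred-shift i) (isCycle w)) σ face)

    kernel⊆image : ∀ z → IsBoundary K' (i - 1ℤ) (restrict K (chain z)) →
      Σ (Cycle L (i - d)) λ w → Homologous K (i - 1ℤ) (fun (homologyMap (connecting i)) w) z
    kernel⊆image z (h , ∂h≈) = w , (λ τ → - h τ) , homologous
      where
      w : Cycle L (i - d)
      w = record { chain = project h ; isCycle = λ τ face →
        let face′ = subst (λ j → IsDimFace L j τ) (pred-shift i) face in
        trans (∂-project h τ (link-disjoint τ (proj₁ face)))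
              (trans (cong (ε τ *_) (∂h≈ (τ ∪ F) (∪F-face {i - 1ℤ} face′)))
                     (project-restrict (chain z) τ)) }

      homologous : ∀ σ → IsDimFace K (i - 1ℤ) σ →
        ∂ K (λ τ → - h τ) σ ≡ ∂ K' (lift (project h)) σ - chain z σ
      homologous σ (σ∈K , dim) = begin
        ∂ K (λ τ → - h τ) σ                      ≡⟨ ∂-neg K h σ ⟩
        - ∂ K h σ                                ≡⟨ cong -_ (∂-restrict K⊆K' h σ) ⟩
        - ∂ K' (restrict K h) σ                  ≡⟨ neg-from-sum (∂-restrict+∂-lift∘project h σ) ⟩
        ∂ K' (lift (project h)) σ - ∂ K' h σ     ≡⟨ cong (_-_ (∂ K' (lift (project h)) σ))
                                                         (trans (∂h≈ σ (K⊆K' σ σ∈K , dim)) (if-true σ∈K)) ⟩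
        ∂ K' (lift (project h)) σ - chain z σ    ∎
        where open ≡-Reasoning

  longExact : LongExact K K' L ∣ F ∣
  longExact = (λ i → homologyMap (inclusion i)) , (λ i → homologyMap (projection i)) ,
              (λ i → homologyMap (connecting i)) , λ i → exact-at-K' i , exact-at-L i , exact-at-K i

-- Independence complexes of hypergraphs

allᵇ⇒ : ∀ {A : Set} (p : A → Bool) {xs : List A} → allᵇ p xs ≡ true → ∀ {x} → x ∈ xs → p x ≡ true
allᵇ⇒ p {y ∷ xs} all (here refl) = ∧-conicalˡ (p y) _ all
allᵇ⇒ p {y ∷ xs} all (there x∈) = allᵇ⇒ p (∧-conicalʳ (p y) _ all) x∈

allᵇ⁺ : ∀ {A : Set} (p : A → Bool) {xs : List A} → (∀ {x} → x ∈ xs → p x ≡ true) → allᵇ p xs ≡ true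
allᵇ⁺ p {[]}     h = refl
allᵇ⁺ p {y ∷ xs} h = ∧-intro (h (here refl)) (allᵇ⁺ p (λ x∈ → h (there x∈)))

allᵇ-false⇒ : ∀ {A : Set} (p : A → Bool) {xs : List A} → allᵇ p xs ≡ false →
  ∃ λ x → x ∈ xs × p x ≡ false
allᵇ-false⇒ p {y ∷ xs} all with p y in py
... | true  with x , x∈ , px ← allᵇ-false⇒ p all = x , there x∈ , px
... | false = y , here refl , py

∈-filterᵇ⁻ : ∀ {A : Set} (p : A → Bool) {xs : List A} {x} → x ∈ filterᵇ p xs → x ∈ xs × p x ≡ true
∈-filterᵇ⁻ p {y ∷ xs} x∈ with p y in py
∈-filterᵇ⁻ p {y ∷ xs} (here refl) | true  = here refl , py
∈-filterᵇ⁻ p {y ∷ xs} (there x∈)  | true  = map₁ there (∈-filterᵇ⁻ p x∈)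
∈-filterᵇ⁻ p {y ∷ xs} x∈          | false = map₁ there (∈-filterᵇ⁻ p x∈)

∈-filterᵇ⁺ : ∀ {A : Set} (p : A → Bool) {xs : List A} {x} → x ∈ xs → p x ≡ true → x ∈ filterᵇ p xs
∈-filterᵇ⁺ p {y ∷ xs} x∈ px with p y in py
∈-filterᵇ⁺ p {y ∷ xs} (here refl) px | true  = here refl
∈-filterᵇ⁺ p {y ∷ xs} (there x∈)  px | true  = there (∈-filterᵇ⁺ p x∈ px)
∈-filterᵇ⁺ p {y ∷ xs} (here refl) px | false with () ← trans (sym px) py
∈-filterᵇ⁺ p {y ∷ xs} (there x∈)  px | false = ∈-filterᵇ⁺ p x∈ px

∈-mapL⁻ : ∀ {A B : Set} (f : A → B) {xs : List A} {y} → y ∈ mapL f xs → ∃ λ x → x ∈ xs × y ≡ f x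
∈-mapL⁻ f {x ∷ xs} (here refl) = x , here refl , refl
∈-mapL⁻ f {x ∷ xs} (there y∈) with x′ , x′∈ , eq ← ∈-mapL⁻ f y∈ = x′ , there x′∈ , eq

∈-mapL⁺ : ∀ {A B : Set} (f : A → B) {xs : List A} {x} → x ∈ xs → f x ∈ mapL f xs
∈-mapL⁺ f (here refl) = here refl
∈-mapL⁺ f (there x∈)  = there (∈-mapL⁺ f x∈)

IndOn⇒⊆ : ∀ {n} {W : Subset n} {C σ} → IndOn W C σ ≡ true → σ ⊆ᵇ W ≡ true
IndOn⇒⊆ {W = W} {C} {σ} σ∈Ind = ∧-conicalˡ (σ ⊆ᵇ W) _ σ∈Ind

IndOn⇒independent : ∀ {n} {W : Subset n} {C σ} → IndOn W C σ ≡ true → ∀ {E} → E ∈ C → E ⊆ᵇ σ ≡ false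
IndOn⇒independent {W = W} {C} {σ} σ∈Ind E∈C =
  not-true (allᵇ⇒ (λ E → not (E ⊆ᵇ σ)) (∧-conicalʳ (σ ⊆ᵇ W) _ σ∈Ind) E∈C)

IndOn⁺ : ∀ {n} {W : Subset n} {C σ} → σ ⊆ᵇ W ≡ true → (∀ {E} → E ∈ C → E ⊆ᵇ σ ≡ false) →
  IndOn W C σ ≡ true
IndOn⁺ σ⊆W independent = ∧-intro σ⊆W (allᵇ⁺ _ (λ E∈C → not-false (independent E∈C)))

IndOn-closed : ∀ {n} (W : Subset n) C → DownwardClosed (IndOn W C)
IndOn-closed W C σ v σv∈Ind = IndOn⁺ {W = W} {C} {σ}
  (⊆ᵇ⁺ σ W (λ u u∈σ → ⊆ᵇ⇒ (σ ∪ ⁅ v ⁆) W (IndOn⇒⊆ {W = W} {C} σv∈Ind) u (∪-keepˡ σ ⁅ v ⁆ u∈σ)))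
  (λ {E} E∈C → case-bool (E ⊆ᵇ σ)
    (λ E⊆σ → true≢false (⊆ᵇ⁺ E (σ ∪ ⁅ v ⁆) (λ u u∈E → ∪-keepˡ σ ⁅ v ⁆ (⊆ᵇ⇒ E σ E⊆σ u u∈E)))
                        (IndOn⇒independent {W = W} {C} σv∈Ind E∈C))
    (λ E⊈σ → E⊈σ))

∈-−ₑ⁺ : ∀ {n} {C : Hypergraph n} {F E} → E ∈ C → E ≢ F → E ∈ C −ₑ F
∈-−ₑ⁺ {F = F} {E} E∈C E≢F =
  ∈-filterᵇ⁺ _ E∈C (not-false (case-bool (E =ᵇ F) (λ E=F → ⊥-elim (E≢F (=ᵇ⇒≡ E F E=F))) (λ E≠F → E≠F)))

∈-−ₑ⁻ : ∀ {n} {C : Hypergraph n} {F E} → E ∈ C −ₑ F → E ∈ C × E ≢ F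
∈-−ₑ⁻ {F = F} E∈ with E∈C , E≠F ← ∈-filterᵇ⁻ _ E∈ =
  E∈C , λ { refl → true≢false (=ᵇ-refl F) (not-true E≠F) }

∈-Nbhd⁺ : ∀ {n} {C : Hypergraph n} {F E v} → E ∈ C → ∣ E ─ F ∣ ≡ 1 → v ∈ᵇ E ─ F ≡ true →
  v ∈ᵇ Nbhd C F ≡ true
∈-Nbhd⁺ {C = E ∷ C} {F} (here refl) one v∈ rewrite one = ∪-keepˡ (E ─ F) (Nbhd C F) v∈
∈-Nbhd⁺ {C = E′ ∷ C} {F} (there E∈) one v∈ with ∣ E′ ─ F ∣ ℕ.≡ᵇ 1
... | true  = ∪-keepʳ (E′ ─ F) (Nbhd C F) (∈-Nbhd⁺ E∈ one v∈)
... | false = ∈-Nbhd⁺ E∈ one v∈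

∈-Nbhd⁻ : ∀ {n} {C : Hypergraph n} {F v} → v ∈ᵇ Nbhd C F ≡ true →
  ∃ λ E → E ∈ C × ∣ E ─ F ∣ ≡ 1 × v ∈ᵇ E ─ F ≡ true
∈-Nbhd⁻ {C = []}    {v = v} v∈ = true≢false v∈ (∈ᵇ-⊥ v)
∈-Nbhd⁻ {C = E ∷ C} {F} {v} v∈ with ∣ E ─ F ∣ ℕ.≡ᵇ 1 in one
... | false with E′ , E′∈ , rest ← ∈-Nbhd⁻ {C = C} v∈ = E′ , there E′∈ , rest
... | true  = case-bool (v ∈ᵇ E ─ F)
  (λ v∈E─F → E , here refl , ℕ.≡ᵇ⇒≡ _ 1 (Equivalence.from T-≡ one) , v∈E─F)
  (λ v∉E─F → let E′ , E′∈ , rest = ∈-Nbhd⁻ {C = C} (in-rest v∉E─F) in E′ , there E′∈ , rest)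
  where
  in-rest : v ∈ᵇ E ─ F ≡ false → v ∈ᵇ Nbhd C F ≡ true
  in-rest v∉E─F = subst (λ b → b ∨ (v ∈ᵇ Nbhd C F) ≡ true) v∉E─F
                                (trans (sym (∈ᵇ-∪ (E ─ F) (Nbhd C F) v)) v∈)

minimal-below : ∀ {n} (Ds : List (Subset n)) k {D} → ∣ D ∣ ℕ.< k → D ∈ Ds →
  ∃ λ D′ → D′ ∈ filterᵇ (λ X → allᵇ (λ Y → not (Y ⊂ᵇ X)) Ds) Ds ×
           (∀ u → u ∈ᵇ D′ ≡ true → u ∈ᵇ D ≡ true)
minimal-below Ds (suc k) {D} (ℕ.s≤s ∣D∣≤k) D∈ = case-bool (allᵇ (λ Y → not (Y ⊂ᵇ D)) Ds)
  (λ minimal → D , ∈-filterᵇ⁺ _ D∈ minimal , λ _ u∈D → u∈D)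
  (λ not-minimal →
    let Y , Y∈ , Y⊄D = allᵇ-false⇒ (λ Y → not (Y ⊂ᵇ D)) not-minimal
        Y⊂D = not-injective Y⊄D
        D′ , D′∈ , D′⊆Y = minimal-below Ds k (ℕ.<-≤-trans (⊂ᵇ⇒∣∣< Y D Y⊂D) ∣D∣≤k) Y∈
    in D′ , D′∈ , λ u u∈D′ → ⊆ᵇ⇒ Y D (∧-conicalˡ (Y ⊆ᵇ D) _ Y⊂D) u (D′⊆Y u u∈D′))

module _ {n} (C : Hypergraph n) (F : Subset n) where

  private
    K′ = Ind (C −ₑ F)
    L  = IndColon C F
    N  = Nbhd C F

  ind-deletion : F ∈ C → ∀ σ → Ind C σ ≡ K′ σ ∧ not (F ⊆ᵇ σ)
  ind-deletion F∈C σ = bool-ext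
    (λ σ∈K → ∧-intro (IndOn⁺ {C = C −ₑ F} {σ} (IndOn⇒⊆ {C = C} σ∈K)
                              (λ E∈ → IndOn⇒independent {C = C} σ∈K (proj₁ (∈-−ₑ⁻ E∈))))
                     (not-false (IndOn⇒independent {C = C} σ∈K F∈C)))
    (λ σ∈K′∖F → let σ∈K′ = ∧-conicalˡ (K′ σ) _ σ∈K′∖F in
      IndOn⁺ {C = C} {σ} (IndOn⇒⊆ {C = C −ₑ F} σ∈K′) λ {E} E∈C → case-bool (E =ᵇ F)
        (λ E=F → subst (λ X → X ⊆ᵇ σ ≡ false) (sym (=ᵇ⇒≡ E F E=F))
                       (not-true (∧-conicalʳ (K′ σ) _ σ∈K′∖F)))
        (λ E≠F → IndOn⇒independent {C = C −ₑ F} σ∈K′ (∈-−ₑ⁺ {C = C} E∈C λ E≡F →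
                   true≢false (subst (λ X → X =ᵇ F ≡ true) (sym E≡F) (=ᵇ-refl F)) E≠F)))

  colonEdge⇒ : ∀ {D} → D ∈ colonEdges C F → ∃ λ E → E ∈ C −ₑ F × D ≡ E ─ F
  colonEdge⇒ D∈ = ∈-mapL⁻ (λ E → E ─ F) {xs = C −ₑ F}
    (proj₁ (∈-filterᵇ⁻ _ {xs = mapL (λ E → E ─ F) (C −ₑ F)}
      (proj₁ (∈-filterᵇ⁻ _ {xs = colonCandidates C F} D∈))))

  link-avoids : ∀ τ → L τ ≡ true → ∀ v → v ∈ᵇ τ ≡ true → v ∈ᵇ F ∪ N ≡ false
  link-avoids τ τ∈L v v∈τ =
    not-true (trans (sym (∈ᵇ-∁ (F ∪ N) v))
                    (⊆ᵇ⇒ τ (colonVertices C F) (IndOn⇒⊆ {C = colonEdges C F} τ∈L) v v∈τ))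

  ind-link-disjoint : ∀ τ → L τ ≡ true → Disjoint τ F
  ind-link-disjoint τ τ∈L v v∈τ = ∨-conicalˡ _ _ (trans (sym (∈ᵇ-∪ F N v)) (link-avoids τ τ∈L v v∈τ))

  link-avoids-N : ∀ τ → L τ ≡ true → ∀ v → v ∈ᵇ τ ≡ true → v ∈ᵇ N ≡ false
  link-avoids-N τ τ∈L v v∈τ = ∨-conicalʳ (v ∈ᵇ F) _ (trans (sym (∈ᵇ-∪ F N v)) (link-avoids τ τ∈L v v∈τ))

  ∪F-dependent : ∀ {τ E} → E ∈ C −ₑ F → (∀ u → u ∈ᵇ E ─ F ≡ true → u ∈ᵇ τ ≡ true) →
    K′ (τ ∪ F) ≡ false
  ∪F-dependent {τ} {E} E∈ E─F⊆τ = case-bool (K′ (τ ∪ F))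
    (λ τF∈K′ → true≢false (⊆ᵇ⁺ E (τ ∪ F) E⊆τF) (IndOn⇒independent {C = C −ₑ F} τF∈K′ E∈))
    (λ τF∉K′ → τF∉K′)
    where
    E⊆τF : ∀ u → u ∈ᵇ E ≡ true → u ∈ᵇ τ ∪ F ≡ true
    E⊆τF u u∈E = case-bool (u ∈ᵇ F) (∪-keepʳ τ F)
      (λ u∉F → ∪-keepˡ τ F (E─F⊆τ u (∈ᵇ-─⁺ {A = E} {F} u∈E u∉F)))

  ind-link-⊇ : ∀ τ → Disjoint τ F → K′ (τ ∪ F) ≡ true → L τ ≡ true
  ind-link-⊇ τ disjoint τF∈K′ = IndOn⁺ (⊆ᵇ⁺ τ (colonVertices C F) avoids) edges-⊈
    where
    dependent : ∀ {E} → E ∈ C −ₑ F → (∀ u → u ∈ᵇ E ─ F ≡ true → u ∈ᵇ τ ≡ true) → ∀ {A : Set} → A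
    dependent E∈ E─F⊆τ = true≢false τF∈K′ (∪F-dependent E∈ E─F⊆τ)

    avoids-N : ∀ v → v ∈ᵇ τ ≡ true → v ∈ᵇ N ≡ false
    avoids-N v v∈τ = case-bool (v ∈ᵇ N) (λ v∈N → case (∈-Nbhd⁻ {C = C} v∈N)) (λ v∉N → v∉N)
      where
      case : (∃ λ E → E ∈ C × ∣ E ─ F ∣ ≡ 1 × v ∈ᵇ E ─ F ≡ true) → v ∈ᵇ N ≡ false
      case (E , E∈C , one , v∈E─F) = dependent
        (∈-−ₑ⁺ E∈C (λ E≡F → let v∈E , v∉F = ∈ᵇ-─⁻ {A = E} {F} v∈E─F in
                              true≢false (subst (λ X → v ∈ᵇ X ≡ true) E≡F v∈E) v∉F))
        (λ u u∈E─F → subst (λ w → w ∈ᵇ τ ≡ true) (∣∣≡1⇒unique (E ─ F) one v∈E─F u∈E─F) v∈τ)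

    avoids : ∀ v → v ∈ᵇ τ ≡ true → v ∈ᵇ colonVertices C F ≡ true
    avoids v v∈τ = trans (∈ᵇ-∁ (F ∪ N) v) (not-false (∪-avoid F N (disjoint v v∈τ) (avoids-N v v∈τ)))

    edges-⊈ : ∀ {D} → D ∈ colonEdges C F → D ⊆ᵇ τ ≡ false
    edges-⊈ {D} D∈ = case-bool (D ⊆ᵇ τ) (λ D⊆τ →
        let E , E∈ , D≡E─F = colonEdge⇒ D∈ in
        dependent E∈ (λ u u∈E─F → ⊆ᵇ⇒ D τ D⊆τ u (subst (λ X → u ∈ᵇ X ≡ true) (sym D≡E─F) u∈E─F)))
      (λ D⊈τ → D⊈τ)

  ind-link-⊆ : (∀ {E E′} → E ∈ C → E′ ∈ C → E ⊆ E′ → E ≡ E′) → F ∈ C →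
    ∀ τ → L τ ≡ true → K′ (τ ∪ F) ≡ true
  ind-link-⊆ antichain F∈C τ τ∈L = IndOn⁺ {C = C −ₑ F} {τ ∪ F} (⊆ᵇ-⊤ (τ ∪ F)) λ {E} E∈ →
    case-bool (E ⊆ᵇ (τ ∪ F)) (λ E⊆τF → dependent E∈ E⊆τF) (λ E⊈τF → E⊈τF)
    where
    dependent : ∀ {E} → E ∈ C −ₑ F → E ⊆ᵇ (τ ∪ F) ≡ true → ∀ {A : Set} → A
    dependent {E} E∈ E⊆τF = by-size ∣ D ∣ refl
      where
      D = E ─ F
      E∈C = proj₁ (∈-−ₑ⁻ {C = C} E∈)

      D⊆τ : ∀ u → u ∈ᵇ D ≡ true → u ∈ᵇ τ ≡ true
      D⊆τ u u∈D = let u∈E , u∉F = ∈ᵇ-─⁻ {A = E} {F} u∈D in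
        trans (sym (∪-outside τ F u∉F)) (⊆ᵇ⇒ E (τ ∪ F) E⊆τF u u∈E)

      D-nonempty : ∃ λ x → x ∈ᵇ D ≡ true
      D-nonempty = case-bool (E ⊆ᵇ F)
        (λ E⊆F → ⊥-elim (proj₂ (∈-−ₑ⁻ {C = C} E∈) (antichain E∈C F∈C (⊆ᵇ⇒⊆ E F E⊆F))))
        (λ E⊈F → let x , x∈E , x∉F = ⊆ᵇ-witness {A = E} {F} E⊈F in x , ∈ᵇ-─⁺ {A = E} {F} x∈E x∉F)
      x   = proj₁ D-nonempty
      x∈D = proj₂ D-nonempty

      D-avoids-N : ∀ u → u ∈ᵇ D ∩ N ≡ false
      D-avoids-N u = trans (∈ᵇ-∩ D N u) (case-bool (u ∈ᵇ D)
        (λ u∈D → trans (cong (_∧ (u ∈ᵇ N)) u∈D) (link-avoids-N τ τ∈L u (D⊆τ u u∈D)))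
        (λ u∉D → cong (_∧ (u ∈ᵇ N)) u∉D))

      -- D ⊆ τ avoids N, so it is no singleton of N; if larger it is a candidate edge of C : F
      -- and hence contains an edge of C : F, which τ cannot contain
      by-size : ∀ k → ∣ D ∣ ≡ k → ∀ {A : Set} → A
      by-size 0 ∣D∣≡0 with () ← subst (1 ℕ.≤_) ∣D∣≡0 (∈ᵇ⇒∣∣≥1 D x∈D)
      by-size 1 ∣D∣≡1 = true≢false (∈-Nbhd⁺ {C = C} E∈C ∣D∣≡1 x∈D) (link-avoids-N τ τ∈L x (D⊆τ x x∈D))
      by-size (suc (suc k)) ∣D∣≡2+k =
        let D′ , D′∈ , D′⊆D = minimal-below (colonCandidates C F) (suc ∣ D ∣) (ℕ.n<1+n ∣ D ∣) D∈candidates in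
        true≢false (⊆ᵇ⁺ D′ τ (λ u u∈D′ → D⊆τ u (D′⊆D u u∈D′)))
                   (IndOn⇒independent {C = colonEdges C F} τ∈L D′∈)
        where
        candidate : (not (∣ D ∣ ℕ.≡ᵇ 0) ∧ not (∣ D ∣ ℕ.≡ᵇ 1) ∧ isEmptyᵇ (D ∩ N)) ≡ true
        candidate rewrite ∣D∣≡2+k = cong (ℕ._≡ᵇ 0) (∣∣≡0 (D ∩ N) D-avoids-N)
        D∈candidates : D ∈ colonCandidates C F
        D∈candidates = ∈-filterᵇ⁺ _ (∈-mapL⁺ (λ E → E ─ F) E∈) candidate

  ind-deletionLink : IsHypergraph C → F ∈ C → DeletionLink (Ind C) K′ L F
  ind-deletionLink (_ , antichain) F∈C = record
    { closed        = IndOn-closed (∁ ⊥) (C −ₑ F)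
    ; deletion      = ind-deletion F∈C
    ; link-disjoint = ind-link-disjoint
    ; link          = λ τ disjoint → bool-ext (ind-link-⊆ antichain F∈C τ) (ind-link-⊇ τ disjoint)
    }

theorem3p1 : ∀ {n} (C : Hypergraph n) → IsHypergraph C →
    (F : Subset n) → F ∈ C →
    LongExact (Ind C) (Ind (C −ₑ F)) (IndColon C F) ∣ F ∣
theorem3p1 C hyp F F∈C = DeletionLinkSequence.longExact (ind-deletionLink C F hyp F∈C)
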